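{- Let $G=(V,E)$ be a simple graph with $n$ vertices and $m$ edges, and for each partition $\lambda\vdash n$ let $c_\lambda(G)$ be the coefficient of $p_\lambda$ in the expansion of the chromatic symmetric function ${\mathbf X}_G$ in the power-sum basis. Let $k$ be the largest integer such that $$\sum_{\lambda\vdash n,\ \ell(\lambda)=k} c_\lambda(G) ~\neq~ (-1)^{n-k}\binom{m}{n-k}.$$ Then the girth of $G$ (the length of a shortest cycle in $G$) is $n-k+1$.
   Context: For a graph $G$, a proper coloring is a map $\kappa:V(G)\to\{1,2,\dots\}$ with $\kappa(v)\ne\kappa(w)$ for adjacent $v,w$; ${\mathbf X}_G=\sum_\kappa\prod_{v\in V(G)}x_{\kappa(v)}$ over all proper colorings, in commuting indeterminates $x_1,x_2,\dots$. The power-sum symmetric functions are $p_k=\sum_i x_i^k$, $p_\lambda=\prod_j p_{\lambda_j}$, and $\ell(\lambda)$ is the number of parts of $\lambda$. The girth of an acyclic graph is $\infty$. -}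

module Defs where

open import Data.Nat as ℕ using (ℕ; zero; suc; _≤_; _<_; _∸_; _≡ᵇ_; _<ᵇ_)
open import Data.Nat.Combinatorics using (_C_)
open import Data.Fin using (Fin; zero; suc; inject₁; fromℕ; toℕ)
open import Data.Fin.Properties using (_≟_)
open import Data.Integer using (+_)
open import Data.Rational using (ℚ; 0ℚ; 1ℚ; _+_; _*_; -_) renaming (_/_ to _÷_)
open import Data.List using (List; []; _∷_; map; concatMap; foldr; filter; length; upTo; applyUpTo; allFin)
open import Data.Nat.ListAction using (sum)
open import Data.Bool.ListAction using (and)
open import Data.Bool using (Bool; true; false; if_then_else_; not; _∧_; T?)
open import Data.Empty using (⊥)
open import Data.Product using (_×_; Σ)
open import Function.Definitions using (Injective)
open import Relation.Binary.PropositionalEquality using (_≡_; _≢_)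
open import Relation.Nullary.Decidable using (⌊_⌋)

record SimpleGraph (n : ℕ) : Set where
  field
    adj   : Fin n → Fin n → Bool
    sym   : ∀ u v → adj u v ≡ adj v u
    irref : ∀ v → adj v v ≡ false

open SimpleGraph public

Adj : ∀ {n} → SimpleGraph n → Fin n → Fin n → Set
Adj G u v = adj G u v ≡ true

count : ∀ {A : Set} → (A → Bool) → List A → ℕ
count p xs = length (filter (λ x → T? (p x)) xs)

edgeCount : ∀ {n} → SimpleGraph n → ℕ
edgeCount {n} G =
  sum (map (λ u → count (λ v → (toℕ u <ᵇ toℕ v) ∧ adj G u v) (allFin n)) (allFin n))

IsCycle : ∀ {n} (G : SimpleGraph n) (h : ℕ) → (Fin (suc h) → Fin n) → Set
IsCycle G h f =
  (2 ≤ h) × Injective _≡_ _≡_ f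
  × (∀ (i : Fin h) → Adj G (f (inject₁ i)) (f (suc i)))
  × Adj G (f (fromℕ h)) (f zero)

HasCycleOfLength : ∀ {n} → SimpleGraph n → ℕ → Set
HasCycleOfLength G zero    = ⊥
HasCycleOfLength G (suc h) = Σ (Fin _ → Fin _) (IsCycle G h)

GirthIs : ∀ {n} → SimpleGraph n → ℕ → Set
GirthIs G g = HasCycleOfLength G g × (∀ g′ → g′ < g → HasCycleOfLength G g′ → ⊥)

Acyclic : ∀ {n} → SimpleGraph n → Set
Acyclic G = ∀ g → HasCycleOfLength G g → ⊥

ℕ→ℚ : ℕ → ℚ
ℕ→ℚ k = (+ k) ÷ 1

sumℚ : List ℚ → ℚ
sumℚ = foldr _+_ 0ℚ

prodℚ : List ℚ → ℚ
prodℚ = foldr _*_ 1ℚ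

powℚ : ℚ → ℕ → ℚ
powℚ x zero    = 1ℚ
powℚ x (suc k) = x * powℚ x k

signℚ : ℕ → ℚ
signℚ zero    = 1ℚ
signℚ (suc j) = - signℚ j

allFuns : (a b : ℕ) → List (Fin a → Fin b)
allFuns zero    b = (λ ()) ∷ []
allFuns (suc a) b =
  concatMap (λ c → map (λ f → λ { zero → c ; (suc i) → f i }) (allFuns a b)) (allFin b)

properB : ∀ {n N} → SimpleGraph n → (Fin n → Fin N) → Bool
properB {n} G κ =
  and (concatMap (λ u → map (λ v → not (adj G u v ∧ ⌊ κ u ≟ κ v ⌋)) (allFin n)) (allFin n))

-- X_G evaluated at (x_1,…,x_N) (i.e. with all other variables set to 0):
-- sum over proper colourings κ : V → {1..N} of ∏_v x_{κ(v)}.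
chromEval : ∀ {n} (N : ℕ) → SimpleGraph n → (Fin N → ℚ) → ℚ
chromEval {n} N G x =
  sumℚ (map (λ κ → if properB G κ then prodℚ (map (λ v → x (κ v)) (allFin n)) else 0ℚ)
            (allFuns n N))

pEval : (N : ℕ) → ℕ → (Fin N → ℚ) → ℚ
pEval N k x = sumℚ (map (λ i → powℚ (x i) k) (allFin N))

pλEval : (N : ℕ) → List ℕ → (Fin N → ℚ) → ℚ
pλEval N λs x = prodℚ (map (λ k → pEval N k x) λs)

-- Partitions of n, as weakly decreasing lists of positive integers.
-- partsBounded f r b : partitions of r with all parts ≤ b (fuel f ≥ r).

partsBounded : ℕ → ℕ → ℕ → List (List ℕ)
partsBounded f       zero    b = [] ∷ []
partsBounded zero    (suc r) b = []
partsBounded (suc f) (suc r) b =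
  concatMap (λ p → map (p ∷_) (partsBounded f (suc r ∸ p) p))
            (filter (λ p → p ℕ.≤? b) (applyUpTo suc (suc r)))

partitions : ℕ → List (List ℕ)
partitions n = partsBounded n n n

sumLength : (n k : ℕ) → (List ℕ → ℚ) → ℚ
sumLength n k c = sumℚ (map (λ λs → if length λs ≡ᵇ k then c λs else 0ℚ) (partitions n))

-- (-1)^{n-k} binom(m, n-k), interpreted as 0 when n - k < 0
signedBinom : (n m k : ℕ) → ℚ
signedBinom n m k = if k ℕ.≤ᵇ n then signℚ (n ∸ k) * ℕ→ℚ (m C (n ∸ k)) else 0ℚ

-- "c is the power-sum expansion of X_G": X_G = Σ_{λ ⊢ n} c_λ p_λ, checked
-- in N = n variables, as an identity of polynomial functions over ℚ.
IsPowerSumExpansion : ∀ {n} → SimpleGraph n → (List ℕ → ℚ) → Set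
IsPowerSumExpansion {n} G c =
  ∀ (x : Fin n → ℚ) →
    chromEval n G x ≡ sumℚ (map (λ λs → c λs * pλEval n λs x) (partitions n))

Deviates : ∀ {n} → SimpleGraph n → (List ℕ → ℚ) → ℕ → Set
Deviates {n} G c k = sumLength n k c ≢ signedBinom n (edgeCount G) k

module Submission where

-- Set t of the variables to 1 and the others to 0.  Each p_λ becomes t ^ ℓ(λ), and
-- inclusion–exclusion over the edges turns X_G into Whitney's expansion
-- Σ_{S ⊆ E} (-1)^|S| t ^ c(S) of the chromatic polynomial, where c(S) is the number of
-- components of (V, S).  Both sides are polynomials of degree ≤ n agreeing at t = 0, …, n, so
-- Σ_{ℓ(λ) = k} c_λ = Σ_{c(S) = k} (-1)^|S|.  Always c(S) + |S| ≥ n, with equality exactly for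
-- forests, and every set of fewer than g edges is a forest, while an edge set containing a
-- cycle has c(S) + g ≤ n + 1, with equality only for the edge set of a shortest cycle.  So
-- the coefficient is (-1)^(n-k) C(m, n-k) for every k > n - g + 1, and at k = n - g + 1 the
-- shortest cycles add (-1)^g times their number, which is positive.

open import Defs renaming (sym to adj-sym)
open import Algebra.Structures using (IsCommutativeSemiring; module IsCommutativeRing)
import Algebra.Properties.Group as GroupProperties
open import Data.Bool using (Bool; true; false; if_then_else_; not; _∧_; T; T?)
open import Data.Bool.ListAction using (and; all)
import Data.Bool.Properties as BoolP
open import Data.Bool.Properties using (⇔→≡)
open import Data.Empty using (⊥; ⊥-elim)
open import Data.Fin using (Fin; zero; suc; toℕ; inject₁; fromℕ; inject≤; punchIn; punchOut)
import Data.Fin.Properties as FinP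
open import Data.Fin.Properties using (_≟_; toℕ-injective; punchIn-punchOut; punchOut-injective)
import Data.Integer as ℤ
import Data.Integer.Properties as ℤP
open import Data.List using (List; []; _∷_; [_]; _++_; map; concatMap; filter; length; allFin; tabulate; foldr; lookup; applyUpTo)
import Data.List.Properties as ListP
open import Data.List.Membership.Propositional using (_∈_; _∉_; find; lose)
open import Data.List.Membership.Propositional.Properties
import Data.List.Membership.DecPropositional as DecMembership
open import Data.List.Relation.Binary.Subset.Propositional using (_⊆_)
open import Data.List.Relation.Unary.All using (All; []; _∷_)
import Data.List.Relation.Unary.All.Properties as All
open import Data.List.Relation.Unary.AllPairs using ([]; _∷_)
open import Data.List.Relation.Unary.Any as Any using (Any; here; there; any?)
import Data.List.Relation.Unary.Any.Properties as AnyP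
open import Data.List.Relation.Unary.Unique.Propositional using (Unique)
import Data.List.Relation.Unary.Unique.Propositional.Properties as Unique
open import Data.Nat as ℕ using (ℕ; zero; suc; _≤_; _<_; _∸_; _^_; z≤n; s≤s)
open import Data.Nat.Combinatorics using (_C_; nCk+nC[k+1]≡[n+1]C[k+1])
import Data.Nat.Coprimality as Coprime
open import Data.Nat.ListAction using (sum; product)
import Data.Nat.Properties as ℕP
open import Data.Product using (Σ; Σ-syntax; _×_; _,_; proj₁; proj₂)
import Data.Product as Product
import Data.Product.Properties as ProductP
open import Data.Rational as ℚ using (ℚ; 0ℚ; 1ℚ; _+_; _*_; -_; _-_; _/_; mkℚ; ↥_; 1/_)
import Data.Rational.Properties as ℚP
open import Data.Rational.Solver using (module +-*-Solver)
open import Data.Sum using (_⊎_; inj₁; inj₂; [_,_]′)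
import Data.Sum as Sum
open import Data.Vec.Functional using (insertAt)
open import Data.Vec.Functional.Properties using (insertAt-lookup; insertAt-punchIn)
open import Function using (_∘_; id; case_of_)
open import Function.Bundles using (mk⇔)
open import Relation.Binary using (tri<; tri≈; tri>)
open import Relation.Binary.PropositionalEquality hiding ([_])
open import Relation.Nullary using (¬_; Dec; yes; no; does)
open import Relation.Nullary.Decidable using (⌊_⌋; dec-true; dec-false; _×-dec_; _→-dec_; map′)

open +-*-Solver using (solve; _:=_; _:+_; _:-_; :-_; _:*_; con)

allFin-map : ∀ {B : Set} n (F : Fin (suc n) → B) → map F (allFin (suc n)) ≡ F zero ∷ map (F ∘ suc) (allFin n)
allFin-map n F = cong (F zero ∷_) (trans (ListP.map-tabulate suc F) (sym (ListP.map-tabulate id (F ∘ suc))))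

extend : ∀ {a} {B : Set} → B → (Fin a → B) → Fin (suc a) → B
extend c f zero    = c
extend c f (suc i) = f i

Congruent : ∀ {a} {B C : Set} → ((Fin a → B) → C) → Set
Congruent F = ∀ {κ κ′} → κ ≗ κ′ → F κ ≡ F κ′

module Sums {A : Set} {_+_ _*_ : A → A → A} {0# 1# : A}
            (isCS : IsCommutativeSemiring _≡_ _+_ _*_ 0# 1#) where

  open IsCommutativeSemiring isCS using (+-assoc; +-comm; +-identityˡ; +-identityʳ; distribˡ; zeroʳ)

  ∑ : List A → A
  ∑ = foldr _+_ 0#

  ∑-map-++ : ∀ {B : Set} (f : B → A) xs ys → ∑ (map f (xs ++ ys)) ≡ ∑ (map f xs) + ∑ (map f ys)
  ∑-map-++ f []       ys = sym (+-identityˡ _)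
  ∑-map-++ f (x ∷ xs) ys = trans (cong (f x +_) (∑-map-++ f xs ys)) (sym (+-assoc (f x) _ _))

  ∑-concatMap : ∀ {B C : Set} (f : B → A) (g : C → List B) xs →
    ∑ (map f (concatMap g xs)) ≡ ∑ (map (λ x → ∑ (map f (g x))) xs)
  ∑-concatMap f g []       = refl
  ∑-concatMap f g (x ∷ xs) =
    trans (∑-map-++ f (g x) (concatMap g xs)) (cong (∑ (map f (g x)) +_) (∑-concatMap f g xs))

  ∑-cong : ∀ {B : Set} {f g : B → A} xs → (∀ x → x ∈ xs → f x ≡ g x) → ∑ (map f xs) ≡ ∑ (map g xs)
  ∑-cong []       h = refl
  ∑-cong (x ∷ xs) h = cong₂ _+_ (h x (here refl)) (∑-cong xs (λ y y∈ → h y (there y∈)))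

  ∑-cong′ : ∀ {B : Set} {f g : B → A} xs → (∀ x → f x ≡ g x) → ∑ (map f xs) ≡ ∑ (map g xs)
  ∑-cong′ xs h = cong ∑ (ListP.map-cong h xs)

  ∑-zero : ∀ {B : Set} {f : B → A} xs → (∀ x → x ∈ xs → f x ≡ 0#) → ∑ (map f xs) ≡ 0#
  ∑-zero xs h = trans (∑-cong xs h) (∑-const-0 xs)
    where
    ∑-const-0 : ∀ {B : Set} (xs : List B) → ∑ (map (λ _ → 0#) xs) ≡ 0#
    ∑-const-0 []       = refl
    ∑-const-0 (x ∷ xs) = trans (cong (0# +_) (∑-const-0 xs)) (+-identityˡ 0#)

  ∑-map-+ : ∀ {B : Set} (f g : B → A) xs → ∑ (map (λ x → f x + g x) xs) ≡ ∑ (map f xs) + ∑ (map g xs)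
  ∑-map-+ f g []       = sym (+-identityˡ 0#)
  ∑-map-+ f g (x ∷ xs) = begin
    (f x + g x) + ∑ (map (λ x → f x + g x) xs) ≡⟨ cong ((f x + g x) +_) (∑-map-+ f g xs) ⟩
    (f x + g x) + (F + G)                      ≡⟨ +-assoc (f x) (g x) (F + G) ⟩
    f x + (g x + (F + G))                      ≡⟨ cong (f x +_) (sym (+-assoc (g x) F G)) ⟩
    f x + ((g x + F) + G)                      ≡⟨ cong (λ z → f x + (z + G)) (+-comm (g x) F) ⟩
    f x + ((F + g x) + G)                      ≡⟨ cong (f x +_) (+-assoc F (g x) G) ⟩
    f x + (F + (g x + G))                      ≡⟨ sym (+-assoc (f x) F (g x + G)) ⟩
    (f x + F) + (g x + G)                      ∎
    where
    open ≡-Reasoning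
    F = ∑ (map f xs)
    G = ∑ (map g xs)

  ∑-swap : ∀ {B C : Set} (f : B → C → A) xs ys →
    ∑ (map (λ x → ∑ (map (f x) ys)) xs) ≡ ∑ (map (λ y → ∑ (map (λ x → f x y) xs)) ys)
  ∑-swap f []       ys = sym (∑-zero ys (λ _ _ → refl))
  ∑-swap f (x ∷ xs) ys = trans (cong (∑ (map (f x) ys) +_) (∑-swap f xs ys))
                               (sym (∑-map-+ (f x) (λ y → ∑ (map (λ x′ → f x′ y) xs)) ys))

  *-∑ : ∀ {B : Set} (c : A) (f : B → A) xs → c * ∑ (map f xs) ≡ ∑ (map (λ x → c * f x) xs)
  *-∑ c f []       = zeroʳ c
  *-∑ c f (x ∷ xs) = trans (distribˡ c (f x) _) (cong ((c * f x) +_) (*-∑ c f xs))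

  ∑-δ : ∀ {t} (x : Fin t) (h : Fin t → A) → ∑ (map (λ b → if does (x ≟ b) then h b else 0#) (allFin t)) ≡ h x
  ∑-δ {suc t} zero h = begin
    ∑ (map (λ b → if does (zero ≟ b) then h b else 0#) (allFin (suc t)))
      ≡⟨ cong ∑ (allFin-map t (λ b → if does (zero ≟ b) then h b else 0#)) ⟩
    h zero + ∑ (map (λ b → if does (zero ≟ suc b) then h (suc b) else 0#) (allFin t))
      ≡⟨ cong (h zero +_) (∑-zero (allFin t) (λ _ _ → refl)) ⟩
    h zero + 0#
      ≡⟨ +-identityʳ (h zero) ⟩
    h zero ∎
    where open ≡-Reasoning
  ∑-δ {suc t} (suc x) h = begin
    ∑ (map (λ b → if does (suc x ≟ b) then h b else 0#) (allFin (suc t)))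
      ≡⟨ cong ∑ (allFin-map t (λ b → if does (suc x ≟ b) then h b else 0#)) ⟩
    0# + ∑ (map (λ b → if does (x ≟ b) then h (suc b) else 0#) (allFin t))
      ≡⟨ +-identityˡ _ ⟩
    ∑ (map (λ b → if does (x ≟ b) then h (suc b) else 0#) (allFin t))
      ≡⟨ ∑-δ x (h ∘ suc) ⟩
    h (suc x) ∎
    where open ≡-Reasoning

  ∑-allFuns-suc : ∀ {a b} (F : (Fin (suc a) → Fin b) → A) → Congruent F →
    ∑ (map F (allFuns (suc a) b)) ≡ ∑ (map (λ c → ∑ (map (λ f → F (extend c f)) (allFuns a b))) (allFin b))
  ∑-allFuns-suc {a} {b} F F-resp = trans (∑-concatMap F _ (allFin b))
    (∑-cong′ (allFin b) (λ c → trans (cong ∑ (sym (ListP.map-∘ (allFuns a b))))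
      (∑-cong′ (allFuns a b) (λ f → F-resp (λ { zero → refl ; (suc i) → refl })))))

module ∑ℚ = Sums (IsCommutativeRing.isCommutativeSemiring ℚP.+-*-isCommutativeRing)
module ∑ℕ = Sums ℕP.+-*-isCommutativeSemiring
open GroupProperties ℚP.+-0-group using (x∙y⁻¹≈ε⇒x≈y)

ℕ→ℚ≡mkℚ : ∀ k → ℕ→ℚ k ≡ mkℚ (ℤ.+ k) 0 (Coprime.sym (Coprime.1-coprimeTo k))
ℕ→ℚ≡mkℚ k = ℚP.normalize-coprime (Coprime.sym (Coprime.1-coprimeTo k))

ℕ→ℚ-+ : ∀ a b → ℕ→ℚ (a ℕ.+ b) ≡ ℕ→ℚ a + ℕ→ℚ b
ℕ→ℚ-+ a b rewrite ℕ→ℚ≡mkℚ a | ℕ→ℚ≡mkℚ b =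
  cong (_/ 1) (sym (cong₂ ℤ._+_ (ℤP.*-identityʳ (ℤ.+ a)) (ℤP.*-identityʳ (ℤ.+ b))))

ℕ→ℚ-* : ∀ a b → ℕ→ℚ (a ℕ.* b) ≡ ℕ→ℚ a * ℕ→ℚ b
ℕ→ℚ-* a b rewrite ℕ→ℚ≡mkℚ a | ℕ→ℚ≡mkℚ b = cong (_/ 1) (ℤP.pos-* a b)

ℕ→ℚ-injective : ∀ {a b} → ℕ→ℚ a ≡ ℕ→ℚ b → a ≡ b
ℕ→ℚ-injective {a} {b} eq = ℤP.+-injective (begin
  ℤ.+ a          ≡⟨ cong ↥_ (ℕ→ℚ≡mkℚ a) ⟨
  ↥ (ℕ→ℚ a)      ≡⟨ cong ↥_ eq ⟩
  ↥ (ℕ→ℚ b)      ≡⟨ cong ↥_ (ℕ→ℚ≡mkℚ b) ⟩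
  ℤ.+ b          ∎)
  where open ≡-Reasoning

ℕ→ℚ-sum : ∀ {B : Set} (f : B → ℕ) xs → ℕ→ℚ (sum (map f xs)) ≡ sumℚ (map (ℕ→ℚ ∘ f) xs)
ℕ→ℚ-sum f []       = refl
ℕ→ℚ-sum f (x ∷ xs) = trans (ℕ→ℚ-+ (f x) _) (cong (ℕ→ℚ (f x) +_) (ℕ→ℚ-sum f xs))

ℕ→ℚ-product : ∀ {B : Set} (f : B → ℕ) xs → ℕ→ℚ (product (map f xs)) ≡ prodℚ (map (ℕ→ℚ ∘ f) xs)
ℕ→ℚ-product f []       = refl
ℕ→ℚ-product f (x ∷ xs) = trans (ℕ→ℚ-* (f x) _) (cong (ℕ→ℚ (f x) *_) (ℕ→ℚ-product f xs))

ℕ→ℚ-^ : ∀ t k → powℚ (ℕ→ℚ t) k ≡ ℕ→ℚ (t ^ k)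
ℕ→ℚ-^ t zero    = refl
ℕ→ℚ-^ t (suc k) = trans (cong (ℕ→ℚ t *_) (ℕ→ℚ-^ t k)) (sym (ℕ→ℚ-* t (t ^ k)))

p≢0∧p*q≡0⇒q≡0 : ∀ {p q} → p ≢ 0ℚ → p * q ≡ 0ℚ → q ≡ 0ℚ
p≢0∧p*q≡0⇒q≡0 {p} {q} p≢0 pq≡0 = begin
  q                ≡⟨ ℚP.*-identityˡ q ⟨
  1ℚ * q           ≡⟨ cong (_* q) (ℚP.*-inverseˡ p) ⟨
  (1/ p * p) * q   ≡⟨ ℚP.*-assoc (1/ p) p q ⟩
  1/ p * (p * q)   ≡⟨ cong (1/ p *_) pq≡0 ⟩
  1/ p * 0ℚ        ≡⟨ ℚP.*-zeroʳ (1/ p) ⟩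
  0ℚ               ∎
  where
  open ≡-Reasoning
  instance _ = ℚ.≢-nonZero p≢0

signℚ-square : ∀ j → signℚ j * signℚ j ≡ 1ℚ
signℚ-square zero    = refl
signℚ-square (suc j) = trans (solve 1 (λ s → (:- s) :* (:- s) := s :* s) refl (signℚ j)) (signℚ-square j)

signℚ≢0 : ∀ j → signℚ j ≢ 0ℚ
signℚ≢0 j s≡0 = ℚP.1≢0 (begin
  1ℚ                ≡⟨ signℚ-square j ⟨
  signℚ j * signℚ j ≡⟨ cong (_* signℚ j) s≡0 ⟩
  0ℚ * signℚ j      ≡⟨ ℚP.*-zeroˡ (signℚ j) ⟩
  0ℚ                ∎)
  where open ≡-Reasoning

-- Polynomials in Horner form

horner : (ℕ → ℚ) → ℕ → ℚ → ℚ
horner a zero    t = 0ℚ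
horner a (suc L) t = a 0 + t * horner (a ∘ suc) L t

quotient : ℚ → (ℕ → ℚ) → ℕ → ℕ → ℚ
quotient r a zero    k       = 0ℚ
quotient r a (suc L) zero    = horner (a ∘ suc) (suc L) r
quotient r a (suc L) (suc k) = quotient r (a ∘ suc) L k

horner-divide : ∀ L a t r → horner a (suc L) t ≡ (t - r) * horner (quotient r a L) L t + horner a (suc L) r
horner-divide zero    a t r =
  solve 3 (λ a₀ t r → a₀ :+ t :* con 0ℚ := (t :- r) :* con 0ℚ :+ (a₀ :+ r :* con 0ℚ)) refl (a 0) t r
horner-divide (suc L) a t r = trans (cong (λ z → a 0 + t * z) (horner-divide L (a ∘ suc) t r))
  (solve 5 (λ a₀ t r Q R → a₀ :+ t :* ((t :- r) :* Q :+ R) := (t :- r) :* (R :+ t :* Q) :+ (a₀ :+ r :* R))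
         refl (a 0) t r (horner (quotient r (a ∘ suc) L) L t) (horner (a ∘ suc) (suc L) r))

horner-1 : ∀ a t → horner a 1 t ≡ a 0
horner-1 a t = solve 2 (λ a₀ t → a₀ :+ t :* con 0ℚ := a₀) refl (a 0) t

quotient-zero⇒zero : ∀ L a r → (∀ k → k < L → quotient r a L k ≡ 0ℚ) → horner a (suc L) r ≡ 0ℚ →
                     ∀ k → k ≤ L → a k ≡ 0ℚ
quotient-zero⇒zero zero    a r _ a[r]≡0 zero    _         = trans (sym (horner-1 a r)) a[r]≡0
quotient-zero⇒zero (suc L) a r q≡0 a[r]≡0 zero    _       = begin
  a 0                        ≡⟨ solve 2 (λ a₀ r → a₀ := a₀ :+ r :* con 0ℚ) refl (a 0) r ⟩
  a 0 + r * 0ℚ               ≡⟨ cong (λ z → a 0 + r * z) (q≡0 0 (s≤s z≤n)) ⟨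
  horner a (suc (suc L)) r   ≡⟨ a[r]≡0 ⟩
  0ℚ                         ∎
  where open ≡-Reasoning
quotient-zero⇒zero (suc L) a r q≡0 a[r]≡0 (suc k) (s≤s k≤L) =
  quotient-zero⇒zero L (a ∘ suc) r (λ k k<L → q≡0 (suc k) (s≤s k<L)) (q≡0 0 (s≤s z≤n)) k k≤L

horner-roots⇒zero : ∀ L s a → (∀ i → i ≤ L → horner a (suc L) (ℕ→ℚ (s ℕ.+ i)) ≡ 0ℚ) →
                    ∀ k → k ≤ L → a k ≡ 0ℚ
horner-roots⇒zero zero    s a roots zero _ = trans (sym (horner-1 a (ℕ→ℚ (s ℕ.+ 0)))) (roots 0 z≤n)
horner-roots⇒zero (suc L) s a roots = quotient-zero⇒zero (suc L) a r quotient≡0 (roots 0 z≤n)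
  where
  r = ℕ→ℚ (s ℕ.+ 0)
  quotient-roots : ∀ i → i ≤ L → horner (quotient r a (suc L)) (suc L) (ℕ→ℚ (suc s ℕ.+ i)) ≡ 0ℚ
  quotient-roots i i≤L = p≢0∧p*q≡0⇒q≡0 x-r≢0 (begin
    (x - r) * Q                              ≡⟨ ℚP.+-identityʳ _ ⟨
    (x - r) * Q + 0ℚ                         ≡⟨ cong ((x - r) * Q +_) (roots 0 z≤n) ⟨
    (x - r) * Q + horner a (suc (suc L)) r   ≡⟨ horner-divide (suc L) a x r ⟨
    horner a (suc (suc L)) x                 ≡⟨ cong (horner a (suc (suc L)) ∘ ℕ→ℚ) (ℕP.+-suc s i) ⟨
    horner a (suc (suc L)) (ℕ→ℚ (s ℕ.+ suc i)) ≡⟨ roots (suc i) (s≤s i≤L) ⟩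
    0ℚ                                       ∎)
    where
    open ≡-Reasoning
    x = ℕ→ℚ (suc s ℕ.+ i)
    Q = horner (quotient r a (suc L)) (suc L) x
    x-r≢0 : x - r ≢ 0ℚ
    x-r≢0 x-r≡0 = ℕP.<-irrefl (sym (ℕP.+-identityʳ s)) (ℕP.<-≤-trans (s≤s (ℕP.m≤m+n s i))
                    (ℕP.≤-reflexive (ℕ→ℚ-injective (x∙y⁻¹≈ε⇒x≈y _ _ x-r≡0))))
  quotient≡0 : ∀ k → k < suc L → quotient r a (suc L) k ≡ 0ℚ
  quotient≡0 k (s≤s k≤L) = horner-roots⇒zero L (suc s) (quotient r a (suc L)) quotient-roots k k≤L

horner-zero : ∀ L t → horner (λ _ → 0ℚ) L t ≡ 0ℚ
horner-zero zero    t = refl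
horner-zero (suc L) t = trans (cong (λ z → 0ℚ + t * z) (horner-zero L t))
                              (solve 1 (λ t → con 0ℚ :+ t :* con 0ℚ := con 0ℚ) refl t)

horner-+ : ∀ L a b t → horner (λ k → a k + b k) L t ≡ horner a L t + horner b L t
horner-+ zero    a b t = refl
horner-+ (suc L) a b t = trans (cong (λ z → (a 0 + b 0) + t * z) (horner-+ L (a ∘ suc) (b ∘ suc) t))
  (solve 5 (λ a₀ b₀ t x y → (a₀ :+ b₀) :+ t :* (x :+ y) := (a₀ :+ t :* x) :+ (b₀ :+ t :* y))
         refl (a 0) (b 0) t (horner (a ∘ suc) L t) (horner (b ∘ suc) L t))

horner-difference : ∀ L a b t → horner (λ k → a k - b k) L t ≡ horner a L t - horner b L t
horner-difference zero    a b t = refl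
horner-difference (suc L) a b t = trans (cong (λ z → (a 0 - b 0) + t * z) (horner-difference L (a ∘ suc) (b ∘ suc) t))
  (solve 5 (λ a₀ b₀ t x y → (a₀ :- b₀) :+ t :* (x :- y) := (a₀ :+ t :* x) :- (b₀ :+ t :* y))
         refl (a 0) (b 0) t (horner (a ∘ suc) L t) (horner (b ∘ suc) L t))

horner-∑ : ∀ {B : Set} L (h : B → ℕ → ℚ) xs t →
  horner (λ k → sumℚ (map (λ x → h x k) xs)) L t ≡ sumℚ (map (λ x → horner (h x) L t) xs)
horner-∑ L h []       t = horner-zero L t
horner-∑ L h (x ∷ xs) t = trans (horner-+ L (h x) (λ k → sumℚ (map (λ x → h x k) xs)) t)
                                (cong (horner (h x) L t +_) (horner-∑ L h xs t))

horner-monomial : ∀ L j c t → j < L → horner (λ k → if j ℕ.≡ᵇ k then c else 0ℚ) L t ≡ c * powℚ t j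
horner-monomial (suc L) zero    c t _         = trans (cong (λ z → c + t * z) (horner-zero L t))
  (solve 2 (λ c t → c :+ t :* con 0ℚ := c :* con 1ℚ) refl c t)
horner-monomial (suc L) (suc j) c t (s≤s j<L) = trans (cong (λ z → 0ℚ + t * z) (horner-monomial L j c t j<L))
  (solve 3 (λ c t p → con 0ℚ :+ t :* (c :* p) := c :* (t :* p)) refl c t (powℚ t j))

horner-injective : ∀ L a b → (∀ i → i ≤ L → horner a (suc L) (ℕ→ℚ i) ≡ horner b (suc L) (ℕ→ℚ i)) →
                   ∀ k → k ≤ L → a k ≡ b k
horner-injective L a b agree k k≤L = x∙y⁻¹≈ε⇒x≈y _ _ (horner-roots⇒zero L 0 (λ k → a k - b k) roots k k≤L)
  where
  roots : ∀ i → i ≤ L → horner (λ k → a k - b k) (suc L) (ℕ→ℚ i) ≡ 0ℚ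
  roots i i≤L = begin
    horner (λ k → a k - b k) (suc L) (ℕ→ℚ i)               ≡⟨ horner-difference (suc L) a b (ℕ→ℚ i) ⟩
    horner a (suc L) (ℕ→ℚ i) - horner b (suc L) (ℕ→ℚ i)    ≡⟨ cong (_- horner b (suc L) (ℕ→ℚ i)) (agree i i≤L) ⟩
    horner b (suc L) (ℕ→ℚ i) - horner b (suc L) (ℕ→ℚ i)    ≡⟨ ℚP.+-inverseʳ (horner b (suc L) (ℕ→ℚ i)) ⟩
    0ℚ                                                     ∎
    where open ≡-Reasoning

-- Both sides of the expansion at a 0/1 point

partsBounded-sound : ∀ f r b λs → λs ∈ partsBounded f r b → All (0 <_) λs × length λs ≤ r
partsBounded-sound f zero b .[] (here refl) = [] , z≤n
partsBounded-sound (suc f) (suc r) b λs λs∈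
  with find (∈-concatMap⁻ _ {xs = filter (λ p → p ℕ.≤? b) (applyUpTo suc (suc r))} λs∈)
... | p , p∈ , λs∈′ with ∈-map⁻ (p ∷_) λs∈′
... | rest , rest∈ , refl with ∈-applyUpTo⁻ suc (proj₁ (∈-filter⁻ (λ p → p ℕ.≤? b) p∈))
... | i , _ , refl with partsBounded-sound f (suc r ∸ suc i) (suc i) rest rest∈
... | positive , length≤ = s≤s z≤n ∷ positive , s≤s (ℕP.≤-trans length≤ (ℕP.m∸n≤m r i))

partitions-sound : ∀ n λs → λs ∈ partitions n → All (0 <_) λs × length λs ≤ n
partitions-sound n = partsBounded-sound n n n

indicator : (n t : ℕ) → Fin n → ℚ
indicator n t i = if toℕ i ℕ.<ᵇ t then 1ℚ else 0ℚ

∑-indicator : ∀ n t → t ≤ n → sumℚ (map (indicator n t) (allFin n)) ≡ ℕ→ℚ t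
∑-indicator zero    zero    _         = refl
∑-indicator (suc n) zero    _         =
  ∑ℚ.∑-zero {f = indicator (suc n) 0} (allFin (suc n)) (λ { zero _ → refl ; (suc i) _ → refl })
∑-indicator (suc n) (suc t) (s≤s t≤n) = begin
  sumℚ (map (indicator (suc n) (suc t)) (allFin (suc n))) ≡⟨ cong sumℚ (allFin-map n (indicator (suc n) (suc t))) ⟩
  1ℚ + sumℚ (map (indicator n t) (allFin n))             ≡⟨ cong (1ℚ +_) (∑-indicator n t t≤n) ⟩
  1ℚ + ℕ→ℚ t                                            ≡⟨ ℕ→ℚ-+ 1 t ⟨
  ℕ→ℚ (suc t)                                           ∎
  where open ≡-Reasoning

powℚ-0-1 : ∀ (b : Bool) k → powℚ (if b then 1ℚ else 0ℚ) (suc k) ≡ (if b then 1ℚ else 0ℚ)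
powℚ-0-1 false k = ℚP.*-zeroˡ (powℚ 0ℚ k)
powℚ-0-1 true  k = trans (ℚP.*-identityˡ (powℚ 1ℚ k)) (powℚ-1 k)
  where
  powℚ-1 : ∀ k → powℚ 1ℚ k ≡ 1ℚ
  powℚ-1 zero    = refl
  powℚ-1 (suc k) = trans (ℚP.*-identityˡ (powℚ 1ℚ k)) (powℚ-1 k)

pEval-indicator : ∀ n t k → t ≤ n → 0 < k → pEval n k (indicator n t) ≡ ℕ→ℚ t
pEval-indicator n t (suc k) t≤n _ =
  trans (∑ℚ.∑-cong′ (allFin n) (λ i → powℚ-0-1 (toℕ i ℕ.<ᵇ t) k)) (∑-indicator n t t≤n)

pλEval-indicator : ∀ n t λs → t ≤ n → All (0 <_) λs → pλEval n λs (indicator n t) ≡ powℚ (ℕ→ℚ t) (length λs)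
pλEval-indicator n t []       t≤n []           = refl
pλEval-indicator n t (k ∷ λs) t≤n (0<k ∷ 0<λs) =
  cong₂ _*_ (pEval-indicator n t k t≤n 0<k) (pλEval-indicator n t λs t≤n 0<λs)

powerSums-indicator : ∀ n t (c : List ℕ → ℚ) → t ≤ n →
  sumℚ (map (λ λs → c λs * pλEval n λs (indicator n t)) (partitions n))
  ≡ horner (λ k → sumLength n k c) (suc n) (ℕ→ℚ t)
powerSums-indicator n t c t≤n = sym (begin
  horner (λ k → sumLength n k c) (suc n) (ℕ→ℚ t)
    ≡⟨ horner-∑ (suc n) (λ λs k → if length λs ℕ.≡ᵇ k then c λs else 0ℚ) (partitions n) (ℕ→ℚ t) ⟩
  sumℚ (map (λ λs → horner (λ k → if length λs ℕ.≡ᵇ k then c λs else 0ℚ) (suc n) (ℕ→ℚ t)) (partitions n))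
    ≡⟨ ∑ℚ.∑-cong (partitions n) monomial ⟩
  sumℚ (map (λ λs → c λs * pλEval n λs (indicator n t)) (partitions n)) ∎)
  where
  open ≡-Reasoning
  monomial : ∀ λs → λs ∈ partitions n →
    horner (λ k → if length λs ℕ.≡ᵇ k then c λs else 0ℚ) (suc n) (ℕ→ℚ t) ≡ c λs * pλEval n λs (indicator n t)
  monomial λs λs∈ = let positive , length≤n = partitions-sound n λs λs∈ in
    trans (horner-monomial (suc n) (length λs) (c λs) (ℕ→ℚ t) (s≤s length≤n))
          (cong (c λs *_) (sym (pλEval-indicator n t λs t≤n positive)))

sumLength-beyond : ∀ n k (c : List ℕ → ℚ) → n < k → sumLength n k c ≡ 0ℚ
sumLength-beyond n k c n<k = ∑ℚ.∑-zero (partitions n) λ λs λs∈ →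
  cong (λ b → if b then c λs else 0ℚ)
       (dec-false (length λs ℕ.≟ k) λ ℓ≡k →
         ℕP.<-irrefl ℓ≡k (ℕP.≤-<-trans (proj₂ (partitions-sound n λs λs∈)) n<k))

Edge : ℕ → Set
Edge a = Fin a × Fin a

upNeighbours : ∀ {n} → SimpleGraph n → Fin n → List (Fin n)
upNeighbours {n} G u = filter (λ v → T? ((toℕ u ℕ.<ᵇ toℕ v) ∧ adj G u v)) (allFin n)

edges : ∀ {n} → SimpleGraph n → List (Edge n)
edges {n} G = concatMap (λ u → map (u ,_) (upNeighbours G u)) (allFin n)

∈-edges⁻ : ∀ {n} (G : SimpleGraph n) {u v} → (u , v) ∈ edges G → toℕ u < toℕ v × Adj G u v
∈-edges⁻ {n} G {u} {v} uv∈ with find (∈-concatMap⁻ _ {xs = allFin n} uv∈)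
... | u′ , _ , uv∈′ with ∈-map⁻ (u′ ,_) uv∈′
... | v′ , v∈ , refl with ∈-filter⁻ (λ v → T? ((toℕ u ℕ.<ᵇ toℕ v) ∧ adj G u v)) {xs = allFin n} v∈
... | _ , ok with toℕ u ℕ.<ᵇ toℕ v in u<ᵇv | adj G u v in uv
... | true | true = ℕP.<ᵇ⇒< (toℕ u) (toℕ v) (subst T (sym u<ᵇv) _) , refl

∈-edges⁺ : ∀ {n} (G : SimpleGraph n) {u v} → toℕ u < toℕ v → Adj G u v → (u , v) ∈ edges G
∈-edges⁺ {n} G {u} {v} u<v uv = ∈-concatMap⁺ _ {xs = allFin n}
  (lose (∈-allFin u) (∈-map⁺ (u ,_) (∈-filter⁺ (λ v → T? ((toℕ u ℕ.<ᵇ toℕ v) ∧ adj G u v)) (∈-allFin v) ok)))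
  where
  ok : T ((toℕ u ℕ.<ᵇ toℕ v) ∧ adj G u v)
  ok rewrite uv | BoolP.∧-identityʳ (toℕ u ℕ.<ᵇ toℕ v) = ℕP.<⇒<ᵇ u<v

monochromatic : ∀ {a t} → (Fin a → Fin t) → Edge a → Bool
monochromatic κ e = does (κ (proj₁ e) ≟ κ (proj₂ e))

sameColour : ∀ {a t} → (Fin a → Fin t) → Edge a → ℕ
sameColour κ e = if monochromatic κ e then 1 else 0

Monochromatic : ∀ {a t} → List (Edge a) → (Fin a → Fin t) → Set
Monochromatic R κ = ∀ {e} → e ∈ R → κ (proj₁ e) ≡ κ (proj₂ e)

Bichromatic : ∀ {a t} → List (Edge a) → (Fin a → Fin t) → Set
Bichromatic R κ = ∀ {e} → e ∈ R → κ (proj₁ e) ≢ κ (proj₂ e)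

noneMonochromatic : ∀ {a t} → (Fin a → Fin t) → List (Edge a) → Bool
noneMonochromatic κ = all (not ∘ monochromatic κ)

and≡true⇒ : ∀ {bs} → and bs ≡ true → ∀ {b} → b ∈ bs → b ≡ true
and≡true⇒ {true ∷ bs} _    (here refl) = refl
and≡true⇒ {true ∷ bs} ok   (there b∈)  = and≡true⇒ ok b∈

and≡true⇐ : ∀ bs → (∀ {b} → b ∈ bs → b ≡ true) → and bs ≡ true
and≡true⇐ []       _    = refl
and≡true⇐ (b ∷ bs) all≡ rewrite all≡ (here refl) = and≡true⇐ bs (all≡ ∘ there)

Proper : ∀ {n t} → SimpleGraph n → (Fin n → Fin t) → Set
Proper G κ = ∀ {u v} → Adj G u v → κ u ≢ κ v

module _ {n t} (G : SimpleGraph n) (κ : Fin n → Fin t) where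

  private
    tests : List Bool
    tests = concatMap (λ u → map (λ v → not (adj G u v ∧ ⌊ κ u ≟ κ v ⌋)) (allFin n)) (allFin n)

  properB⇒Proper : properB G κ ≡ true → Proper G κ
  properB⇒Proper ok {u} {v} uv κu≡κv with and≡true⇒ ok (∈-concatMap⁺ _ {xs = allFin n}
      (lose (∈-allFin u) (∈-map⁺ (λ v → not (adj G u v ∧ ⌊ κ u ≟ κ v ⌋)) (∈-allFin v))))
  ... | test≡true rewrite uv with κ u ≟ κ v
  ... | no κu≢κv = κu≢κv κu≡κv

  Proper⇒properB : Proper G κ → properB G κ ≡ true
  Proper⇒properB proper = and≡true⇐ tests test≡true
    where
    test≡true : ∀ {b} → b ∈ tests → b ≡ true
    test≡true b∈ with find (∈-concatMap⁻ _ {xs = allFin n} b∈)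
    ... | u , _ , b∈′ with ∈-map⁻ (λ v → not (adj G u v ∧ ⌊ κ u ≟ κ v ⌋)) b∈′
    ... | v , _ , refl with adj G u v in uv | κ u ≟ κ v
    ... | false | _            = refl
    ... | true  | no _         = refl
    ... | true  | yes κu≡κv    = ⊥-elim (proper uv κu≡κv)

  Proper⇒Bichromatic : Proper G κ → Bichromatic (edges G) κ
  Proper⇒Bichromatic proper e∈ = proper (proj₂ (∈-edges⁻ G e∈))

  Bichromatic⇒Proper : Bichromatic (edges G) κ → Proper G κ
  Bichromatic⇒Proper bichromatic {u} {v} uv with ℕP.<-cmp (toℕ u) (toℕ v)
  ... | tri< u<v _ _ = bichromatic (∈-edges⁺ G u<v uv)
  ... | tri> _ _ v<u = bichromatic (∈-edges⁺ G v<u (trans (adj-sym G v u) uv)) ∘ sym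
  ... | tri≈ _ u≡v _ with toℕ-injective u≡v
  ...   | refl = case trans (sym uv) (irref G u) of λ ()

noneMonochromatic⇒Bichromatic : ∀ {a t} (κ : Fin a → Fin t) R → noneMonochromatic κ R ≡ true → Bichromatic R κ
noneMonochromatic⇒Bichromatic κ R ok {e} e∈ κe≡ with and≡true⇒ ok (∈-map⁺ (not ∘ monochromatic κ) e∈)
... | test≡true with κ (proj₁ e) ≟ κ (proj₂ e)
... | no κe≢ = κe≢ κe≡

Bichromatic⇒noneMonochromatic : ∀ {a t} (κ : Fin a → Fin t) R → Bichromatic R κ → noneMonochromatic κ R ≡ true
Bichromatic⇒noneMonochromatic κ R bichromatic = and≡true⇐ (map (not ∘ monochromatic κ) R) test≡true
  where
  test≡true : ∀ {b} → b ∈ map (not ∘ monochromatic κ) R → b ≡ true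
  test≡true b∈ with ∈-map⁻ (not ∘ monochromatic κ) b∈
  ... | e , e∈ , refl = cong not (dec-false (κ (proj₁ e) ≟ κ (proj₂ e)) (bichromatic e∈))

properB≡noneMonochromatic : ∀ {n t} (G : SimpleGraph n) (κ : Fin n → Fin t) →
                            properB G κ ≡ noneMonochromatic κ (edges G)
properB≡noneMonochromatic G κ = ⇔→≡ (mk⇔
  (λ ok → Bichromatic⇒noneMonochromatic κ (edges G) (Proper⇒Bichromatic G κ (properB⇒Proper G κ ok)))
  (λ ok → Proper⇒properB G κ (Bichromatic⇒Proper G κ (noneMonochromatic⇒Bichromatic κ (edges G) ok))))

𝟙 : Bool → ℚ
𝟙 b = if b then 1ℚ else 0ℚ

𝟙-noneMonochromatic : ∀ {a t} (κ : Fin a → Fin t) R →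
  𝟙 (noneMonochromatic κ R) ≡ prodℚ (map (λ e → 1ℚ - ℕ→ℚ (sameColour κ e)) R)
𝟙-noneMonochromatic κ []      = refl
𝟙-noneMonochromatic κ (e ∷ R) with κ (proj₁ e) ≟ κ (proj₂ e)
... | yes _ = sym (ℚP.*-zeroˡ (prodℚ (map (λ e → 1ℚ - ℕ→ℚ (sameColour κ e)) R)))
... | no _  = trans (𝟙-noneMonochromatic κ R) (sym (ℚP.*-identityˡ _))

sublists : ∀ {A : Set} → List A → List (List A)
sublists []       = [] ∷ []
sublists (x ∷ xs) = sublists xs ++ map (x ∷_) (sublists xs)

inclusion-exclusion : ∀ {B : Set} (a : B → ℚ) xs →
  prodℚ (map (λ e → 1ℚ - a e) xs) ≡ sumℚ (map (λ S → signℚ (length S) * prodℚ (map a S)) (sublists xs))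
inclusion-exclusion a []       = sym (trans (ℚP.+-identityʳ (1ℚ * 1ℚ)) (ℚP.*-identityˡ 1ℚ))
inclusion-exclusion a (x ∷ xs) = sym (begin
  sumℚ (map term (sublists xs ++ map (x ∷_) (sublists xs)))
    ≡⟨ ∑ℚ.∑-map-++ term (sublists xs) (map (x ∷_) (sublists xs)) ⟩
  ∑xs + sumℚ (map term (map (x ∷_) (sublists xs)))
    ≡⟨ cong (λ z → ∑xs + sumℚ z) (ListP.map-∘ (sublists xs)) ⟨
  ∑xs + sumℚ (map (λ S → term (x ∷ S)) (sublists xs))
    ≡⟨ cong (∑xs +_) (∑ℚ.∑-cong′ (sublists xs) (λ S →
         solve 3 (λ s ax p → (:- s) :* (ax :* p) := (:- ax) :* (s :* p)) refl (signℚ (length S)) (a x) (prodℚ (map a S)))) ⟩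
  ∑xs + sumℚ (map (λ S → (- a x) * term S) (sublists xs))
    ≡⟨ cong (∑xs +_) (∑ℚ.*-∑ (- a x) term (sublists xs)) ⟨
  ∑xs + (- a x) * ∑xs
    ≡⟨ solve 2 (λ s ax → s :+ (:- ax) :* s := (con 1ℚ :- ax) :* s) refl ∑xs (a x) ⟩
  (1ℚ - a x) * ∑xs
    ≡⟨ cong ((1ℚ - a x) *_) (inclusion-exclusion a xs) ⟨
  (1ℚ - a x) * prodℚ (map (λ e → 1ℚ - a e) xs) ∎)
  where
  open ≡-Reasoning
  term : List _ → ℚ
  term S = signℚ (length S) * prodℚ (map a S)
  ∑xs = sumℚ (map term (sublists xs))

∑-indicator-weighted : ∀ N t (t≤N : t ≤ N) (H : Fin N → ℚ) →
  sumℚ (map (λ c → indicator N t c * H c) (allFin N)) ≡ sumℚ (map (λ c → H (inject≤ c t≤N)) (allFin t))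
∑-indicator-weighted zero    zero    z≤n       H = refl
∑-indicator-weighted (suc N) zero    z≤n       H =
  ∑ℚ.∑-zero {f = λ c → indicator (suc N) 0 c * H c} (allFin (suc N))
    (λ { zero _ → ℚP.*-zeroˡ (H zero) ; (suc c) _ → ℚP.*-zeroˡ (H (suc c)) })
∑-indicator-weighted (suc N) (suc t) (s≤s t≤N) H = begin
  sumℚ (map (λ c → indicator (suc N) (suc t) c * H c) (allFin (suc N)))
    ≡⟨ cong sumℚ (allFin-map N (λ c → indicator (suc N) (suc t) c * H c)) ⟩
  1ℚ * H zero + sumℚ (map (λ c → indicator N t c * H (suc c)) (allFin N))
    ≡⟨ cong₂ _+_ (ℚP.*-identityˡ (H zero)) (∑-indicator-weighted N t t≤N (H ∘ suc)) ⟩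
  H zero + sumℚ (map (λ c → H (suc (inject≤ c t≤N))) (allFin t))
    ≡⟨ cong sumℚ (allFin-map t (λ c → H (inject≤ c (s≤s t≤N)))) ⟨
  sumℚ (map (λ c → H (inject≤ c (s≤s t≤N))) (allFin (suc t))) ∎
  where open ≡-Reasoning

𝟙-* : ∀ b (w : ℚ) → (if b then w else 0ℚ) ≡ 𝟙 b * w
𝟙-* false w = sym (ℚP.*-zeroˡ w)
𝟙-* true  w = sym (ℚP.*-identityˡ w)

∑-colourings-at-indicator : ∀ a N t (t≤N : t ≤ N) (P : (Fin a → Fin N) → Bool) → Congruent P →
  sumℚ (map (λ κ → if P κ then prodℚ (map (indicator N t ∘ κ) (allFin a)) else 0ℚ) (allFuns a N))
  ≡ sumℚ (map (λ κ → 𝟙 (P (λ v → inject≤ (κ v) t≤N))) (allFuns a t))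
∑-colourings-at-indicator zero    N t t≤N P P-cong = cong (λ b → 𝟙 b + 0ℚ) (P-cong λ ())
∑-colourings-at-indicator (suc a) N t t≤N P P-cong = begin
  sumℚ (map term (allFuns (suc a) N))
    ≡⟨ ∑ℚ.∑-allFuns-suc term term-cong ⟩
  sumℚ (map (λ c → sumℚ (map (λ f → term (extend c f)) (allFuns a N))) (allFin N))
    ≡⟨ ∑ℚ.∑-cong′ (allFin N) (λ c → ∑ℚ.∑-cong′ (allFuns a N) (peel c)) ⟩
  sumℚ (map (λ c → sumℚ (map (λ f → indicator N t c * term′ c f) (allFuns a N))) (allFin N))
    ≡⟨ ∑ℚ.∑-cong′ (allFin N) (λ c → ∑ℚ.*-∑ (indicator N t c) (term′ c) (allFuns a N)) ⟨
  sumℚ (map (λ c → indicator N t c * sumℚ (map (term′ c) (allFuns a N))) (allFin N))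
    ≡⟨ ∑-indicator-weighted N t t≤N (λ c → sumℚ (map (term′ c) (allFuns a N))) ⟩
  sumℚ (map (λ c → sumℚ (map (term′ (inj c)) (allFuns a N))) (allFin t))
    ≡⟨ ∑ℚ.∑-cong′ (allFin t) (λ c → ∑-colourings-at-indicator a N t t≤N (P ∘ extend (inj c))
                                      (λ κ≗κ′ → P-cong (extend-cong (inj c) κ≗κ′))) ⟩
  sumℚ (map (λ c → sumℚ (map (λ f → 𝟙 (P (extend (inj c) (inj ∘ f)))) (allFuns a t))) (allFin t))
    ≡⟨ ∑ℚ.∑-cong′ (allFin t) (λ c → ∑ℚ.∑-cong′ (allFuns a t) (λ f → cong 𝟙 (P-cong (extend-inj c f)))) ⟩
  sumℚ (map (λ c → sumℚ (map (λ f → term″ (extend c f)) (allFuns a t))) (allFin t))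
    ≡⟨ ∑ℚ.∑-allFuns-suc term″ (λ κ≗κ′ → cong 𝟙 (P-cong (cong inj ∘ κ≗κ′))) ⟨
  sumℚ (map term″ (allFuns (suc a) t)) ∎
  where
  open ≡-Reasoning
  inj : Fin t → Fin N
  inj c = inject≤ c t≤N
  term : (Fin (suc a) → Fin N) → ℚ
  term κ = if P κ then prodℚ (map (indicator N t ∘ κ) (allFin (suc a))) else 0ℚ
  term′ : Fin N → (Fin a → Fin N) → ℚ
  term′ c f = if P (extend c f) then prodℚ (map (indicator N t ∘ f) (allFin a)) else 0ℚ
  term″ : (Fin (suc a) → Fin t) → ℚ
  term″ κ = 𝟙 (P (inj ∘ κ))
  extend-cong : ∀ c {f f′ : Fin a → Fin N} → f ≗ f′ → extend c f ≗ extend c f′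
  extend-cong c f≗f′ zero    = refl
  extend-cong c f≗f′ (suc i) = f≗f′ i
  extend-inj : ∀ c (f : Fin a → Fin t) → extend (inj c) (inj ∘ f) ≗ inj ∘ extend c f
  extend-inj c f zero    = refl
  extend-inj c f (suc i) = refl
  term-cong : Congruent term
  term-cong κ≗κ′ = cong₂ (λ b w → if b then w else 0ℚ) (P-cong κ≗κ′)
                         (cong prodℚ (ListP.map-cong (cong (indicator N t) ∘ κ≗κ′) (allFin (suc a))))
  peel : ∀ c f → term (extend c f) ≡ indicator N t c * term′ c f
  peel c f = begin
    term (extend c f)
      ≡⟨ 𝟙-* (P (extend c f)) _ ⟩
    𝟙 (P (extend c f)) * prodℚ (map (indicator N t ∘ extend c f) (allFin (suc a)))
      ≡⟨ cong (λ z → 𝟙 (P (extend c f)) * prodℚ z) (allFin-map a (indicator N t ∘ extend c f)) ⟩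
    𝟙 (P (extend c f)) * (indicator N t c * prodℚ (map (indicator N t ∘ f) (allFin a)))
      ≡⟨ solve 3 (λ i x p → i :* (x :* p) := x :* (i :* p)) refl (𝟙 (P (extend c f))) (indicator N t c) _ ⟩
    indicator N t c * (𝟙 (P (extend c f)) * prodℚ (map (indicator N t ∘ f) (allFin a)))
      ≡⟨ cong (indicator N t c *_) (𝟙-* (P (extend c f)) _) ⟨
    indicator N t c * term′ c f ∎

allSameColour : ∀ {a t} → List (Edge a) → (Fin a → Fin t) → ℕ
allSameColour R κ = product (map (sameColour κ) R)

#monochromatic : (t a : ℕ) → List (Edge a) → ℕ
#monochromatic t a R = sum (map (allSameColour R) (allFuns a t))

sameColour-inject≤ : ∀ {a t N} (t≤N : t ≤ N) (κ : Fin a → Fin t) e →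
                     sameColour (λ v → inject≤ (κ v) t≤N) e ≡ sameColour κ e
sameColour-inject≤ t≤N κ (u , v) with κ u ≟ κ v
... | yes κu≡κv = cong (λ b → if b then 1 else 0)
                       (dec-true (inject≤ (κ u) t≤N ≟ inject≤ (κ v) t≤N) (cong (λ c → inject≤ c t≤N) κu≡κv))
... | no κu≢κv  = cong (λ b → if b then 1 else 0)
                       (dec-false (inject≤ (κ u) t≤N ≟ inject≤ (κ v) t≤N)
                                  (κu≢κv ∘ FinP.inject≤-injective t≤N t≤N _ _))

whitney-expansion : ∀ {n} (G : SimpleGraph n) t → t ≤ n →
  chromEval n G (indicator n t) ≡ sumℚ (map (λ S → signℚ (length S) * ℕ→ℚ (#monochromatic t n S)) (sublists (edges G)))
whitney-expansion {n} G t t≤n = begin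
  chromEval n G (indicator n t)
    ≡⟨ ∑-colourings-at-indicator n n t t≤n (properB G) properB-cong ⟩
  sumℚ (map (λ κ → 𝟙 (properB G (inj ∘ κ))) (allFuns n t))
    ≡⟨ ∑ℚ.∑-cong′ (allFuns n t) (λ κ → trans (cong 𝟙 (properB≡noneMonochromatic G (inj ∘ κ)))
                                             (𝟙-noneMonochromatic (inj ∘ κ) E)) ⟩
  sumℚ (map (λ κ → prodℚ (map (λ e → 1ℚ - ℕ→ℚ (sameColour (inj ∘ κ) e)) E)) (allFuns n t))
    ≡⟨ ∑ℚ.∑-cong′ (allFuns n t) (λ κ → inclusion-exclusion (ℕ→ℚ ∘ sameColour (inj ∘ κ)) E) ⟩
  sumℚ (map (λ κ → sumℚ (map (λ S → signℚ (length S) * prodℚ (map (ℕ→ℚ ∘ sameColour (inj ∘ κ)) S))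
                            (sublists E)))
            (allFuns n t))
    ≡⟨ ∑ℚ.∑-cong′ (allFuns n t) (λ κ → ∑ℚ.∑-cong′ (sublists E) (λ S →
         cong (signℚ (length S) *_) (allSameColour-ℚ κ S))) ⟩
  sumℚ (map (λ κ → sumℚ (map (λ S → signℚ (length S) * ℕ→ℚ (allSameColour S κ)) (sublists E))) (allFuns n t))
    ≡⟨ ∑ℚ.∑-swap (λ κ S → signℚ (length S) * ℕ→ℚ (allSameColour S κ)) (allFuns n t) (sublists E) ⟩
  sumℚ (map (λ S → sumℚ (map (λ κ → signℚ (length S) * ℕ→ℚ (allSameColour S κ)) (allFuns n t))) (sublists E))
    ≡⟨ ∑ℚ.∑-cong′ (sublists E) (λ S →
         trans (sym (∑ℚ.*-∑ (signℚ (length S)) (ℕ→ℚ ∘ allSameColour S) (allFuns n t)))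
               (cong (signℚ (length S) *_) (sym (ℕ→ℚ-sum (allSameColour S) (allFuns n t))))) ⟩
  sumℚ (map (λ S → signℚ (length S) * ℕ→ℚ (#monochromatic t n S)) (sublists E)) ∎
  where
  open ≡-Reasoning
  E = edges G
  inj : Fin t → Fin n
  inj c = inject≤ c t≤n
  properB-cong : Congruent (properB G)
  properB-cong {κ} {κ′} κ≗κ′ = begin
    properB G κ                         ≡⟨ properB≡noneMonochromatic G κ ⟩
    noneMonochromatic κ E               ≡⟨ cong and (ListP.map-cong (λ e →
                                             cong not (cong₂ (λ x y → does (x ≟ y)) (κ≗κ′ (proj₁ e)) (κ≗κ′ (proj₂ e)))) E) ⟩
    noneMonochromatic κ′ E              ≡⟨ properB≡noneMonochromatic G κ′ ⟨
    properB G κ′                        ∎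
  allSameColour-ℚ : ∀ κ S → prodℚ (map (ℕ→ℚ ∘ sameColour (inj ∘ κ)) S) ≡ ℕ→ℚ (allSameColour S κ)
  allSameColour-ℚ κ S = trans (cong prodℚ (ListP.map-cong (cong ℕ→ℚ ∘ sameColour-inject≤ t≤n κ) S))
                                (sym (ℕ→ℚ-product (sameColour κ) S))

-- Contracting edges

-- The quotient map identifying v with u.
contract : ∀ {a} (u v : Fin (suc a)) → u ≢ v → Fin (suc a) → Fin a
contract u v u≢v i with i ≟ v
... | yes _   = punchOut {i = v} {j = u} (u≢v ∘ sym)
... | no i≢v  = punchOut {i = v} {j = i} (i≢v ∘ sym)

mapEdge : ∀ {a b} → (Fin a → Fin b) → Edge a → Edge b
mapEdge f e = f (proj₁ e) , f (proj₂ e)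

-- Contract the edges one at a time.  An edge whose ends are already identified becomes a
-- loop and is counted by the nullity.
mutual
  components : (a : ℕ) → List (Edge a) → ℕ
  components a []            = a
  components a ((u , v) ∷ R) = componentsAfter a u v R (u ≟ v)

  componentsAfter : (a : ℕ) (u v : Fin a) → List (Edge a) → Dec (u ≡ v) → ℕ
  componentsAfter a       u v R (yes _)  = components a R
  componentsAfter (suc a) u v R (no u≢v) = components a (map (mapEdge (contract u v u≢v)) R)

mutual
  nullity : (a : ℕ) → List (Edge a) → ℕ
  nullity a []            = 0
  nullity a ((u , v) ∷ R) = nullityAfter a u v R (u ≟ v)

  nullityAfter : (a : ℕ) (u v : Fin a) → List (Edge a) → Dec (u ≡ v) → ℕ
  nullityAfter a       u v R (yes _)  = suc (nullity a R)
  nullityAfter (suc a) u v R (no u≢v) = nullity a (map (mapEdge (contract u v u≢v)) R)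

mutual
  components+length≡size+nullity : ∀ a R → components a R ℕ.+ length R ≡ a ℕ.+ nullity a R
  components+length≡size+nullity a []            = refl
  components+length≡size+nullity a ((u , v) ∷ R) = components+length≡size+nullity′ a u v R (u ≟ v)

  components+length≡size+nullity′ : ∀ a u v R d → componentsAfter a u v R d ℕ.+ suc (length R) ≡ a ℕ.+ nullityAfter a u v R d
  components+length≡size+nullity′ a u v R (yes _) = begin
    components a R ℕ.+ suc (length R)   ≡⟨ ℕP.+-suc _ (length R) ⟩
    suc (components a R ℕ.+ length R)   ≡⟨ cong suc (components+length≡size+nullity a R) ⟩
    suc (a ℕ.+ nullity a R)             ≡⟨ ℕP.+-suc a _ ⟨
    a ℕ.+ suc (nullity a R)             ∎
    where open ≡-Reasoning
  components+length≡size+nullity′ (suc a) u v R (no u≢v) = begin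
    components a R′ ℕ.+ suc (length R)  ≡⟨ ℕP.+-suc _ (length R) ⟩
    suc (components a R′ ℕ.+ length R)  ≡⟨ cong (λ k → suc (components a R′ ℕ.+ k)) (ListP.length-map _ R) ⟨
    suc (components a R′ ℕ.+ length R′) ≡⟨ cong suc (components+length≡size+nullity a R′) ⟩
    suc a ℕ.+ nullity a R′              ∎
    where
    open ≡-Reasoning
    R′ = map (mapEdge (contract u v u≢v)) R

mutual
  components≤size : ∀ a R → components a R ≤ a
  components≤size a []            = ℕP.≤-refl
  components≤size a ((u , v) ∷ R) = components≤size′ a u v R (u ≟ v)

  components≤size′ : ∀ a u v R d → componentsAfter a u v R d ≤ a
  components≤size′ a       u v R (yes _)  = components≤size a R
  components≤size′ (suc a) u v R (no u≢v) = ℕP.m≤n⇒m≤1+n (components≤size a (map (mapEdge (contract u v u≢v)) R))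

∑-allFuns-insertAt : ∀ {a t} (v : Fin (suc a)) (Ψ : (Fin (suc a) → Fin t) → ℕ) → Congruent Ψ →
  sum (map Ψ (allFuns (suc a) t)) ≡ sum (map (λ b → sum (map (λ κ → Ψ (insertAt κ v b)) (allFuns a t))) (allFin t))
∑-allFuns-insertAt {a} {t} zero Ψ Ψ-cong = trans (∑ℕ.∑-allFuns-suc Ψ Ψ-cong)
  (∑ℕ.∑-cong′ (allFin t) (λ b → ∑ℕ.∑-cong′ (allFuns a t) (λ κ → Ψ-cong (λ { zero → refl ; (suc i) → refl }))))
∑-allFuns-insertAt {suc a} {t} (suc w) Ψ Ψ-cong = begin
  sum (map Ψ (allFuns (suc (suc a)) t))
    ≡⟨ ∑ℕ.∑-allFuns-suc Ψ Ψ-cong ⟩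
  sum (map (λ c → sum (map (λ κ → Ψ (extend c κ)) (allFuns (suc a) t))) (allFin t))
    ≡⟨ ∑ℕ.∑-cong′ (allFin t) (λ c →
         ∑-allFuns-insertAt w (Ψ ∘ extend c) (λ κ≗κ′ → Ψ-cong (extend-cong c κ≗κ′))) ⟩
  sum (map (λ c → sum (map (λ b → sum (map (λ κ → Ψ (extend c (insertAt κ w b))) (allFuns a t))) (allFin t))) (allFin t))
    ≡⟨ ∑ℕ.∑-swap (λ c b → sum (map (λ κ → Ψ (extend c (insertAt κ w b))) (allFuns a t))) (allFin t) (allFin t) ⟩
  sum (map (λ b → sum (map (λ c → sum (map (λ κ → Ψ (extend c (insertAt κ w b))) (allFuns a t))) (allFin t))) (allFin t))
    ≡⟨ ∑ℕ.∑-cong′ (allFin t) (λ b → ∑ℕ.∑-cong′ (allFin t) (λ c → ∑ℕ.∑-cong′ (allFuns a t) (λ κ →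
         Ψ-cong (λ { zero → refl ; (suc i) → refl })))) ⟩
  sum (map (λ b → sum (map (λ c → sum (map (λ κ → Ψ (insertAt (extend c κ) (suc w) b)) (allFuns a t))) (allFin t))) (allFin t))
    ≡⟨ ∑ℕ.∑-cong′ (allFin t) (λ b → ∑ℕ.∑-allFuns-suc (λ κ → Ψ (insertAt κ (suc w) b))
         (λ κ≗κ′ → Ψ-cong (insertAt-cong (suc w) b κ≗κ′))) ⟨
  sum (map (λ b → sum (map (λ κ → Ψ (insertAt κ (suc w) b)) (allFuns (suc a) t))) (allFin t)) ∎
  where
  open ≡-Reasoning
  extend-cong : ∀ c {f f′ : Fin (suc a) → Fin t} → f ≗ f′ → extend c f ≗ extend c f′
  extend-cong c f≗f′ zero    = refl
  extend-cong c f≗f′ (suc i) = f≗f′ i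
  insertAt-cong : ∀ {m} (w : Fin (suc m)) b {κ κ′ : Fin m → Fin t} → κ ≗ κ′ → insertAt κ w b ≗ insertAt κ′ w b
  insertAt-cong zero    b κ≗κ′ zero    = refl
  insertAt-cong zero    b κ≗κ′ (suc i) = κ≗κ′ i
  insertAt-cong {suc m} (suc w) b κ≗κ′ zero    = κ≗κ′ zero
  insertAt-cong {suc m} (suc w) b κ≗κ′ (suc i) = insertAt-cong w b (κ≗κ′ ∘ suc) i

insertAt-≢ : ∀ {a} {B : Set} (κ : Fin a → B) (v : Fin (suc a)) b {i} (i≢v : i ≢ v) →
             insertAt κ v b i ≡ κ (punchOut (i≢v ∘ sym))
insertAt-≢ κ v b {i} i≢v = begin
  insertAt κ v b i                                ≡⟨ cong (insertAt κ v b) (punchIn-punchOut (i≢v ∘ sym)) ⟨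
  insertAt κ v b (punchIn v (punchOut (i≢v ∘ sym))) ≡⟨ insertAt-punchIn κ v b _ ⟩
  κ (punchOut (i≢v ∘ sym))                        ∎
  where open ≡-Reasoning

insertAt-contract : ∀ {a} {B : Set} (κ : Fin a → B) (u v : Fin (suc a)) (u≢v : u ≢ v) →
                    insertAt κ v (κ (punchOut (u≢v ∘ sym))) ≗ κ ∘ contract u v u≢v
insertAt-contract κ u v u≢v i with i ≟ v
... | yes refl = insertAt-lookup κ i _
... | no i≢v   = insertAt-≢ κ v _ i≢v

∑-sameColour-contract : ∀ {a t} (u v : Fin (suc a)) (u≢v : u ≢ v) (Ψ : (Fin (suc a) → Fin t) → ℕ) → Congruent Ψ →
  sum (map (λ κ → sameColour κ (u , v) ℕ.* Ψ κ) (allFuns (suc a) t))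
  ≡ sum (map (λ κ → Ψ (κ ∘ contract u v u≢v)) (allFuns a t))
∑-sameColour-contract {a} {t} u v u≢v Ψ Ψ-cong = begin
  sum (map (λ κ → sameColour κ (u , v) ℕ.* Ψ κ) (allFuns (suc a) t))
    ≡⟨ ∑-allFuns-insertAt v (λ κ → sameColour κ (u , v) ℕ.* Ψ κ) weighted-cong ⟩
  sum (map (λ b → sum (map (λ κ → sameColour (insertAt κ v b) (u , v) ℕ.* Ψ (insertAt κ v b)) (allFuns a t))) (allFin t))
    ≡⟨ ∑ℕ.∑-cong′ (allFin t) (λ b → ∑ℕ.∑-cong′ (allFuns a t) (δ-form b)) ⟩
  sum (map (λ b → sum (map (λ κ → if does (κ u′ ≟ b) then Ψ (insertAt κ v b) else 0) (allFuns a t))) (allFin t))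
    ≡⟨ ∑ℕ.∑-swap (λ b κ → if does (κ u′ ≟ b) then Ψ (insertAt κ v b) else 0) (allFin t) (allFuns a t) ⟩
  sum (map (λ κ → sum (map (λ b → if does (κ u′ ≟ b) then Ψ (insertAt κ v b) else 0) (allFin t))) (allFuns a t))
    ≡⟨ ∑ℕ.∑-cong′ (allFuns a t) (λ κ → ∑ℕ.∑-δ (κ u′) (λ b → Ψ (insertAt κ v b))) ⟩
  sum (map (λ κ → Ψ (insertAt κ v (κ u′))) (allFuns a t))
    ≡⟨ ∑ℕ.∑-cong′ (allFuns a t) (λ κ → Ψ-cong (insertAt-contract κ u v u≢v)) ⟩
  sum (map (λ κ → Ψ (κ ∘ contract u v u≢v)) (allFuns a t)) ∎
  where
  open ≡-Reasoning
  u′ = punchOut (u≢v ∘ sym)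
  weighted-cong : Congruent (λ κ → sameColour κ (u , v) ℕ.* Ψ κ)
  weighted-cong κ≗κ′ =
    cong₂ ℕ._*_ (cong₂ (λ x y → if does (x ≟ y) then 1 else 0) (κ≗κ′ u) (κ≗κ′ v)) (Ψ-cong κ≗κ′)
  if-1-* : ∀ (c : Bool) y → (if c then 1 else 0) ℕ.* y ≡ (if c then y else 0)
  if-1-* false y = refl
  if-1-* true  y = ℕP.+-identityʳ y
  δ-form : ∀ b κ → sameColour (insertAt κ v b) (u , v) ℕ.* Ψ (insertAt κ v b)
                   ≡ (if does (κ u′ ≟ b) then Ψ (insertAt κ v b) else 0)
  δ-form b κ = trans (cong (λ c → (if c then 1 else 0) ℕ.* Ψ (insertAt κ v b))
                           (cong₂ (λ x y → does (x ≟ y)) (insertAt-≢ κ v b u≢v) (insertAt-lookup κ v b)))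
                     (if-1-* (does (κ u′ ≟ b)) (Ψ (insertAt κ v b)))

#colourings : ∀ a t → sum (map (λ _ → 1) (allFuns a t)) ≡ t ^ a
#colourings zero    t = refl
#colourings (suc a) t = begin
  sum (map (λ _ → 1) (allFuns (suc a) t))                               ≡⟨ ∑ℕ.∑-allFuns-suc {a} {t} (λ _ → 1) (λ _ → refl) ⟩
  sum (map (λ _ → sum (map (λ _ → 1) (allFuns a t))) (allFin t))        ≡⟨ ∑ℕ.∑-cong′ (allFin t) (λ _ → #colourings a t) ⟩
  sum (map (λ _ → t ^ a) (allFin t))                                    ≡⟨ ∑-const (allFin t) (t ^ a) ⟩
  length (allFin t) ℕ.* t ^ a                                           ≡⟨ cong (ℕ._* t ^ a) (ListP.length-tabulate {n = t} id) ⟩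
  t ℕ.* t ^ a                                                           ∎
  where
  open ≡-Reasoning
  ∑-const : ∀ {B : Set} (xs : List B) k → sum (map (λ _ → k) xs) ≡ length xs ℕ.* k
  ∑-const []       k = refl
  ∑-const (x ∷ xs) k = cong (k ℕ.+_) (∑-const xs k)

allSameColour-cong : ∀ {a t} (R : List (Edge a)) → Congruent {a} {Fin t} (allSameColour R)
allSameColour-cong R κ≗κ′ = cong product (ListP.map-cong (λ e →
  cong₂ (λ x y → if does (x ≟ y) then 1 else 0) (κ≗κ′ (proj₁ e)) (κ≗κ′ (proj₂ e))) R)

mutual
  #monochromatic≡^components : ∀ t a R → #monochromatic t a R ≡ t ^ components a R
  #monochromatic≡^components t a []            = #colourings a t
  #monochromatic≡^components t a ((u , v) ∷ R) = #monochromatic≡^components′ t a u v R (u ≟ v)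

  #monochromatic≡^components′ : ∀ t a u v R d → #monochromatic t a ((u , v) ∷ R) ≡ t ^ componentsAfter a u v R d
  #monochromatic≡^components′ t a u v R (yes refl) =
    trans (∑ℕ.∑-cong′ (allFuns a t) (λ κ → trans (cong (λ c → (if c then 1 else 0) ℕ.* allSameColour R κ)
                                                        (dec-true (κ u ≟ κ u) refl))
                                                  (ℕP.+-identityʳ (allSameColour R κ))))
          (#monochromatic≡^components t a R)
  #monochromatic≡^components′ t (suc a) u v R (no u≢v) = begin
    #monochromatic t (suc a) ((u , v) ∷ R)
      ≡⟨ ∑-sameColour-contract u v u≢v (allSameColour R) (allSameColour-cong R) ⟩
    sum (map (λ κ → allSameColour R (κ ∘ contract u v u≢v)) (allFuns a t))
      ≡⟨ ∑ℕ.∑-cong′ (allFuns a t) (λ κ → cong product (ListP.map-∘ R)) ⟩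
    #monochromatic t a (map (mapEdge (contract u v u≢v)) R)
      ≡⟨ #monochromatic≡^components t a (map (mapEdge (contract u v u≢v)) R) ⟩
    t ^ components a (map (mapEdge (contract u v u≢v)) R) ∎
    where open ≡-Reasoning

-- The coefficient of t ^ k in Whitney's expansion.
whitney : ∀ {n} → SimpleGraph n → ℕ → ℚ
whitney {n} G k = sumℚ (map (λ S → if components n S ℕ.≡ᵇ k then signℚ (length S) else 0ℚ) (sublists (edges G)))

chromEval-indicator≡horner-whitney : ∀ {n} (G : SimpleGraph n) t → t ≤ n →
  chromEval n G (indicator n t) ≡ horner (whitney G) (suc n) (ℕ→ℚ t)
chromEval-indicator≡horner-whitney {n} G t t≤n = begin
  chromEval n G (indicator n t)
    ≡⟨ whitney-expansion G t t≤n ⟩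
  sumℚ (map (λ S → signℚ (length S) * ℕ→ℚ (#monochromatic t n S)) (sublists (edges G)))
    ≡⟨ ∑ℚ.∑-cong′ (sublists (edges G)) monomial ⟨
  sumℚ (map (λ S → horner (λ k → if components n S ℕ.≡ᵇ k then signℚ (length S) else 0ℚ) (suc n) (ℕ→ℚ t))
            (sublists (edges G)))
    ≡⟨ horner-∑ (suc n) (λ S k → if components n S ℕ.≡ᵇ k then signℚ (length S) else 0ℚ)
                (sublists (edges G)) (ℕ→ℚ t) ⟨
  horner (whitney G) (suc n) (ℕ→ℚ t) ∎
  where
  open ≡-Reasoning
  monomial : ∀ S → horner (λ k → if components n S ℕ.≡ᵇ k then signℚ (length S) else 0ℚ) (suc n) (ℕ→ℚ t)
                   ≡ signℚ (length S) * ℕ→ℚ (#monochromatic t n S)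
  monomial S = begin
    horner (λ k → if components n S ℕ.≡ᵇ k then signℚ (length S) else 0ℚ) (suc n) (ℕ→ℚ t)
      ≡⟨ horner-monomial (suc n) (components n S) (signℚ (length S)) (ℕ→ℚ t) (s≤s (components≤size n S)) ⟩
    signℚ (length S) * powℚ (ℕ→ℚ t) (components n S)
      ≡⟨ cong (signℚ (length S) *_) (ℕ→ℚ-^ t (components n S)) ⟩
    signℚ (length S) * ℕ→ℚ (t ^ components n S)
      ≡⟨ cong (λ z → signℚ (length S) * ℕ→ℚ z) (#monochromatic≡^components t n S) ⟨
    signℚ (length S) * ℕ→ℚ (#monochromatic t n S) ∎

sumLength≡whitney : ∀ {n} (G : SimpleGraph n) (c : List ℕ → ℚ) → IsPowerSumExpansion G c →
                    ∀ k → k ≤ n → sumLength n k c ≡ whitney G k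
sumLength≡whitney {n} G c expansion = horner-injective n (λ k → sumLength n k c) (whitney G) λ t t≤n → begin
  horner (λ k → sumLength n k c) (suc n) (ℕ→ℚ t)                        ≡⟨ powerSums-indicator n t c t≤n ⟨
  sumℚ (map (λ λs → c λs * pλEval n λs (indicator n t)) (partitions n))   ≡⟨ expansion (indicator n t) ⟨
  chromEval n G (indicator n t)                                          ≡⟨ chromEval-indicator≡horner-whitney G t t≤n ⟩
  horner (whitney G) (suc n) (ℕ→ℚ t)                                     ∎
  where open ≡-Reasoning

-- Walks, paths and cycles in edge sets

Unique-∷ : ∀ {A : Set} {x : A} {xs} → x ∉ xs → Unique xs → Unique (x ∷ xs)
Unique-∷ x∉xs u = All.¬Any⇒All¬ _ x∉xs ∷ u

Unique-++⁻ʳ : ∀ {A : Set} (xs : List A) {ys} → Unique (xs ++ ys) → Unique ys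
Unique-++⁻ʳ []       u       = u
Unique-++⁻ʳ (x ∷ xs) (_ ∷ u) = Unique-++⁻ʳ xs u

_∈ᶠ?_ : ∀ {a} (x : Fin a) xs → Dec (x ∈ xs)
x ∈ᶠ? xs = DecMembership._∈?_ _≟_ x xs

Joins : ∀ {a} → List (Edge a) → Fin a → Fin a → Set
Joins R x y = (x , y) ∈ R ⊎ (y , x) ∈ R

data Walk {a} (R : List (Edge a)) : Fin a → Fin a → Set where
  []  : ∀ {x} → Walk R x x
  _∷_ : ∀ {x y z} → Joins R x y → Walk R y z → Walk R x z

_++ʷ_ : ∀ {a} {R : List (Edge a)} {x y z} → Walk R x y → Walk R y z → Walk R x z
[]      ++ʷ w′ = w′
(j ∷ w) ++ʷ w′ = j ∷ (w ++ʷ w′)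

contract-collapse : ∀ {a} (u v : Fin (suc a)) (u≢v : u ≢ v) {x y} → contract u v u≢v x ≡ contract u v u≢v y →
                    x ≡ y ⊎ (x ≡ u × y ≡ v) ⊎ (x ≡ v × y ≡ u)
contract-collapse u v u≢v {x} {y} eq with x ≟ v | y ≟ v
... | yes x≡v  | yes y≡v  = inj₁ (trans x≡v (sym y≡v))
... | yes refl | no y≢v   = inj₂ (inj₂ (refl , sym (punchOut-injective (u≢v ∘ sym) (y≢v ∘ sym) eq)))
... | no x≢v   | yes refl = inj₂ (inj₁ (punchOut-injective (x≢v ∘ sym) (u≢v ∘ sym) eq , refl))
... | no x≢v   | no y≢v   = inj₁ (punchOut-injective (x≢v ∘ sym) (y≢v ∘ sym) eq)

module _ {a} (u v : Fin (suc a)) (u≢v : u ≢ v) (R : List (Edge (suc a))) where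

  private
    f = contract u v u≢v

  walk-collapsed : ∀ {x y} → f x ≡ f y → Walk ((u , v) ∷ R) x y
  walk-collapsed {x} {y} fx≡fy with contract-collapse u v u≢v {x} {y} fx≡fy
  ... | inj₁ refl               = []
  ... | inj₂ (inj₁ (refl , refl)) = inj₁ (here refl) ∷ []
  ... | inj₂ (inj₂ (refl , refl)) = inj₂ (here refl) ∷ []

  walk-lift : ∀ {z₁ z₂} → Walk (map (mapEdge f) R) z₁ z₂ →
              ∀ {x y} → f x ≡ z₁ → f y ≡ z₂ → Walk ((u , v) ∷ R) x y
  walk-lift []              fx≡ fy≡ = walk-collapsed (trans fx≡ (sym fy≡))
  walk-lift (inj₁ e∈ ∷ w) fx≡ fy≡ with ∈-map⁻ (mapEdge f) e∈
  ... | (p , q) , pq∈ , refl = walk-collapsed fx≡ ++ʷ (inj₁ (there pq∈) ∷ walk-lift w refl fy≡)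
  walk-lift (inj₂ e∈ ∷ w) fx≡ fy≡ with ∈-map⁻ (mapEdge f) e∈
  ... | (p , q) , pq∈ , refl = walk-collapsed fx≡ ++ʷ (inj₂ (there pq∈) ∷ walk-lift w refl fy≡)

map-split : ∀ {A B : Set} (f : A → B) (R : List A) (Q₁ : List B) {b Q₂} → map f R ≡ Q₁ ++ b ∷ Q₂ →
  Σ[ R₁ ∈ List A ] Σ[ e ∈ A ] Σ[ R₂ ∈ List A ] (R ≡ R₁ ++ e ∷ R₂) × (map f R₁ ≡ Q₁) × (f e ≡ b)
map-split f (x ∷ R) []       refl = [] , x , R , refl , refl , refl
map-split f (x ∷ R) (q ∷ Q₁) eq with map-split f R Q₁ (ListP.∷-injectiveʳ eq)
... | R₁ , e , R₂ , refl , refl , fe≡b = x ∷ R₁ , e , R₂ , refl , cong (_∷ map f R₁) (ListP.∷-injectiveˡ eq) , fe≡b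

RedundantEdge : ∀ {a} → List (Edge a) → Set
RedundantEdge {a} R = Σ[ R₁ ∈ List (Edge a) ] Σ[ e ∈ Edge a ] Σ[ R₂ ∈ List (Edge a) ]
                      (R ≡ R₁ ++ e ∷ R₂) × Walk R₁ (proj₁ e) (proj₂ e)

mutual
  nullity>0⇒redundantEdge : ∀ a (R : List (Edge a)) → 0 < nullity a R → RedundantEdge R
  nullity>0⇒redundantEdge a ((u , v) ∷ R) 0<n = nullity>0⇒redundantEdge′ a u v R (u ≟ v) 0<n

  nullity>0⇒redundantEdge′ : ∀ a u v (R : List (Edge a)) d → 0 < nullityAfter a u v R d → RedundantEdge ((u , v) ∷ R)
  nullity>0⇒redundantEdge′ a u v R (yes refl) _ = [] , (u , u) , R , refl , []
  nullity>0⇒redundantEdge′ (suc a) u v R (no u≢v) 0<n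
    with nullity>0⇒redundantEdge a (map (mapEdge (contract u v u≢v)) R) 0<n
  ... | Q₁ , _ , _ , eq , w with map-split (mapEdge (contract u v u≢v)) R Q₁ eq
  ... | R₁ , e , R₂ , refl , refl , refl = (u , v) ∷ R₁ , e , R₂ , refl , walk-lift u v u≢v R₁ w refl refl

data Chain {a} (T : Fin a → Fin a → Set) : Fin a → List (Fin a) → Set where
  []  : ∀ {x} → Chain T x []
  _∷_ : ∀ {x y vs} → T x y → Chain T y vs → Chain T x (y ∷ vs)

end : ∀ {a} → Fin a → List (Fin a) → Fin a
end x []       = x
end x (y ∷ vs) = end y vs

Chain-map : ∀ {a} {T T′ : Fin a → Fin a → Set} → (∀ {x y} → T x y → T′ x y) →
            ∀ {x vs} → Chain T x vs → Chain T′ x vs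
Chain-map f []      = []
Chain-map f (t ∷ c) = f t ∷ Chain-map f c

Chain-suffix : ∀ {a} {T : Fin a → Fin a → Set} {y vs} (A : List (Fin a)) {x B} →
               Chain T y vs → y ∷ vs ≡ A ++ x ∷ B → Chain T x B
Chain-suffix []            c       refl = c
Chain-suffix (_ ∷ [])      (t ∷ c) refl = c
Chain-suffix (_ ∷ a′ ∷ A)  (t ∷ c) refl = Chain-suffix (a′ ∷ A) c refl

end-suffix : ∀ {a} {y : Fin a} {vs} (A : List (Fin a)) {x B} → y ∷ vs ≡ A ++ x ∷ B → end y vs ≡ end x B
end-suffix                 []           refl = refl
end-suffix {vs = z ∷ vs}   (_ ∷ [])     refl = refl
end-suffix {vs = z ∷ vs}   (_ ∷ a′ ∷ A) refl = end-suffix (a′ ∷ A) refl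

walk⇒path : ∀ {a} {R : List (Edge a)} {x y} → Walk R x y →
            Σ[ vs ∈ List (Fin a) ] Chain (Joins R) x vs × Unique (x ∷ vs) × end x vs ≡ y
walk⇒path [] = [] , [] , [] ∷ [] , refl
walk⇒path {x = x} (_∷_ {y = y} j w) with walk⇒path w
... | vs , c , u , end≡ with x ∈ᶠ? (y ∷ vs)
...   | no x∉  = y ∷ vs , j ∷ c , Unique-∷ x∉ u , end≡
...   | yes x∈ with ∈-∃++ x∈
...     | A , B , eq = B , Chain-suffix A c eq , Unique-++⁻ʳ A (subst Unique eq u) , trans (sym (end-suffix A eq)) end≡

∈-sublists⇒⊆ : ∀ {A : Set} (xs : List A) {S} → S ∈ sublists xs → S ⊆ xs
∈-sublists⇒⊆ []       (here refl) ()
∈-sublists⇒⊆ (x ∷ xs) S∈ e∈S with ∈-++⁻ (sublists xs) S∈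
... | inj₁ S∈′ = there (∈-sublists⇒⊆ xs S∈′ e∈S)
... | inj₂ S∈′ with ∈-map⁻ (x ∷_) S∈′
...   | S′ , S′∈ , refl with e∈S
...     | here refl = here refl
...     | there e∈S′ = there (∈-sublists⇒⊆ xs S′∈ e∈S′)

∈-sublists⇒Unique : ∀ {A : Set} (xs : List A) {S} → Unique xs → S ∈ sublists xs → Unique S
∈-sublists⇒Unique []       []      (here refl) = []
∈-sublists⇒Unique (x ∷ xs) (x∉ ∷ u) S∈ with ∈-++⁻ (sublists xs) S∈
... | inj₁ S∈′ = ∈-sublists⇒Unique xs u S∈′
... | inj₂ S∈′ with ∈-map⁻ (x ∷_) S∈′
...   | S′ , S′∈ , refl =
        Unique-∷ (All.All¬⇒¬Any x∉ ∘ ∈-sublists⇒⊆ xs S′∈) (∈-sublists⇒Unique xs u S′∈)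

∈-pairs⇒proj₁∈ : ∀ {A B : Set} {g : A → List B} us {e} → e ∈ concatMap (λ u → map (u ,_) (g u)) us → proj₁ e ∈ us
∈-pairs⇒proj₁∈ {g = g} (u ∷ us) e∈ with ∈-++⁻ (map (u ,_) (g u)) e∈
... | inj₁ e∈u  with ∈-map⁻ (u ,_) e∈u
...   | _ , _ , refl = here refl
∈-pairs⇒proj₁∈ (u ∷ us) e∈ | inj₂ e∈us = there (∈-pairs⇒proj₁∈ us e∈us)

Unique-pairs : ∀ {A B : Set} {g : A → List B} {us} → Unique us → (∀ u → Unique (g u)) →
               Unique (concatMap (λ u → map (u ,_) (g u)) us)
Unique-pairs                 []           _      = []
Unique-pairs {g = g} {u ∷ us} (u∉ ∷ uniq) uniq-g =
  Unique.++⁺ (Unique.map⁺ (cong proj₂) (uniq-g u)) (Unique-pairs uniq uniq-g) λ { (e∈ , e∈′) →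
    All.All¬⇒¬Any u∉ (subst (_∈ us) (first e∈) (∈-pairs⇒proj₁∈ us e∈′)) }
  where
  first : ∀ {e} → e ∈ map (u ,_) (g u) → proj₁ e ≡ u
  first e∈ with ∈-map⁻ (u ,_) e∈
  ... | _ , _ , refl = refl

Unique-edges : ∀ {n} (G : SimpleGraph n) → Unique (edges G)
Unique-edges {n} G = Unique-pairs (Unique.allFin⁺ n) (λ _ → Unique.filter⁺ _ (Unique.allFin⁺ n))

Unique-++-∷⇒∉ : ∀ {A : Set} (A₁ : List A) {x B} → Unique (A₁ ++ x ∷ B) → x ∉ A₁
Unique-++-∷⇒∉ (a ∷ A₁) (a∉ ∷ _) (here refl) = All.All¬⇒¬Any a∉ (∈-++⁺ʳ A₁ (here refl))
Unique-++-∷⇒∉ (a ∷ A₁) (_ ∷ u)  (there x∈)  = Unique-++-∷⇒∉ A₁ u x∈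

CycleList : ∀ {a} → (Fin a → Fin a → Set) → Fin a → List (Fin a) → Set
CycleList T x vs = Unique (x ∷ vs) × Chain T x vs × 2 ≤ length vs × T (end x vs) x

CycleList-map : ∀ {a} {T T′ : Fin a → Fin a → Set} → (∀ {x y} → T x y → T′ x y) →
               ∀ {x vs} → CycleList T x vs → CycleList T′ x vs
CycleList-map f (u , c , 2≤ , closing) = u , Chain-map f c , 2≤ , f closing

Joins⇒Adj : ∀ {n} (G : SimpleGraph n) {S} → S ⊆ edges G → ∀ {x y} → Joins S x y → Adj G x y
Joins⇒Adj G S⊆E (inj₁ xy∈) = proj₂ (∈-edges⁻ G (S⊆E xy∈))
Joins⇒Adj G S⊆E {x} {y} (inj₂ yx∈) = trans (adj-sym G x y) (proj₂ (∈-edges⁻ G (S⊆E yx∈)))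

nullity>0⇒cycle : ∀ {n} (G : SimpleGraph n) {S} → S ∈ sublists (edges G) → 0 < nullity n S →
                  Σ[ x ∈ Fin n ] Σ[ vs ∈ List (Fin n) ] CycleList (Joins S) x vs
nullity>0⇒cycle {n} G {S} S∈ 0<nullity with nullity>0⇒redundantEdge n S 0<nullity
... | S₁ , (x , y) , S₂ , refl , w with walk⇒path w
... | vs , c , uniq , end≡y =
  x , vs , uniq , Chain-map (Joins-mono ∈-++⁺ˡ) c , 2≤length vs c end≡y , subst (λ z → Joins S z x) (sym end≡y) (inj₂ xy∈)
  where
  S⊆E = ∈-sublists⇒⊆ (edges G) S∈
  Joins-mono : ∀ {R R′ : List (Edge n)} → R ⊆ R′ → ∀ {p q} → Joins R p q → Joins R′ p q
  Joins-mono R⊆R′ (inj₁ pq∈) = inj₁ (R⊆R′ pq∈)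
  Joins-mono R⊆R′ (inj₂ qp∈) = inj₂ (R⊆R′ qp∈)
  xy∈ : (x , y) ∈ S₁ ++ (x , y) ∷ S₂
  xy∈ = ∈-++⁺ʳ S₁ (here refl)
  x<y : toℕ x < toℕ y
  x<y = proj₁ (∈-edges⁻ G (S⊆E xy∈))
  2≤length : ∀ vs → Chain (Joins S₁) x vs → end x vs ≡ y → 2 ≤ length vs
  2≤length []           _                 refl = ⊥-elim (ℕP.<-irrefl refl x<y)
  2≤length (_ ∷ [])     (inj₁ xy∈S₁ ∷ []) refl =
    ⊥-elim (Unique-++-∷⇒∉ S₁ (∈-sublists⇒Unique (edges G) (Unique-edges G) S∈) xy∈S₁)
  2≤length (_ ∷ [])     (inj₂ yx∈S₁ ∷ []) refl =
    ⊥-elim (ℕP.<-asym x<y (proj₁ (∈-edges⁻ G (S⊆E (∈-++⁺ˡ yx∈S₁)))))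
  2≤length (_ ∷ _ ∷ _)  _                 _    = s≤s (s≤s z≤n)

lookup-injective : ∀ {A : Set} (xs : List A) → Unique xs → ∀ {i j} → lookup xs i ≡ lookup xs j → i ≡ j
lookup-injective (x ∷ xs) (x∉ ∷ u) {zero}  {zero}  eq = refl
lookup-injective (x ∷ xs) (x∉ ∷ u) {zero}  {suc j} eq = ⊥-elim (All.All¬⇒¬Any x∉ (subst (_∈ xs) (sym eq) (∈-lookup j)))
lookup-injective (x ∷ xs) (x∉ ∷ u) {suc i} {zero}  eq = ⊥-elim (All.All¬⇒¬Any x∉ (subst (_∈ xs) eq (∈-lookup i)))
lookup-injective (x ∷ xs) (x∉ ∷ u) {suc i} {suc j} eq = cong suc (lookup-injective xs u eq)

CycleList⇒HasCycleOfLength : ∀ {n} (G : SimpleGraph n) {x vs} → CycleList (Adj G) x vs → HasCycleOfLength G (suc (length vs))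
CycleList⇒HasCycleOfLength G {x} {vs} (uniq , c , 2≤ , closing) =
  lookup (x ∷ vs) , 2≤ , lookup-injective (x ∷ vs) uniq , steps c , subst (λ z → Adj G z x) (sym (lookup-end x vs)) closing
  where
  steps : ∀ {x vs} → Chain (Adj G) x vs → ∀ (i : Fin (length vs)) → Adj G (lookup (x ∷ vs) (inject₁ i)) (lookup vs i)
  steps (t ∷ c) zero    = t
  steps (t ∷ c) (suc i) = steps c i
  lookup-end : ∀ x vs → lookup (x ∷ vs) (fromℕ (length vs)) ≡ end x vs
  lookup-end x []       = refl
  lookup-end x (y ∷ vs) = lookup-end y vs

HasCycleOfLength⇒CycleList : ∀ {n} (G : SimpleGraph n) h → HasCycleOfLength G (suc h) →
  Σ[ x ∈ Fin n ] Σ[ vs ∈ List (Fin n) ] length vs ≡ h × CycleList (Adj G) x vs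
HasCycleOfLength⇒CycleList G h (f , 2≤h , f-inj , steps , closing) =
  f zero , tabulate (f ∘ suc) , ListP.length-tabulate (f ∘ suc) ,
  Unique.tabulate⁺ f-inj , chain f steps , subst (2 ≤_) (sym (ListP.length-tabulate (f ∘ suc))) 2≤h ,
  subst (λ z → Adj G z (f zero)) (sym (end-tabulate f)) closing
  where
  chain : ∀ {k} (g : Fin (suc k) → Fin _) → (∀ (i : Fin k) → Adj G (g (inject₁ i)) (g (suc i))) →
          Chain (Adj G) (g zero) (tabulate (g ∘ suc))
  chain {zero}  g steps = []
  chain {suc k} g steps = steps zero ∷ chain (g ∘ suc) (steps ∘ suc)
  end-tabulate : ∀ {k} (g : Fin (suc k) → Fin _) → end (g zero) (tabulate (g ∘ suc)) ≡ g (fromℕ k)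
  end-tabulate {zero}  g = refl
  end-tabulate {suc k} g = end-tabulate (g ∘ suc)

-- Every edge has an end outside U and outside the earlier edges, so the edges form a forest.
data Fresh {a} : List (Fin a) → List (Edge a) → Set where
  []   : ∀ {U} → Fresh U []
  cons : ∀ {U x y R} → x ≢ y → (x ∉ U ⊎ y ∉ U) → Fresh (x ∷ y ∷ U) R → Fresh U ((x , y) ∷ R)

Fresh-map : ∀ {a b} (f : Fin a → Fin b) {U R} → (∀ {z w} → f z ≡ f w → z ≡ w ⊎ z ∈ U) →
            Fresh U R → Fresh (map f U) (map (mapEdge f) R)
Fresh-map f         f-inj []                           = []
Fresh-map f {U} {_} f-inj (cons {x = x} {y} x≢y new fresh) =
  cons fx≢fy (Sum.map (∉-image x) (∉-image y) new)
       (Fresh-map f (λ eq → Sum.map₂ (there ∘ there) (f-inj eq)) fresh)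
  where
  ∉-image : ∀ z → z ∉ U → f z ∉ map f U
  ∉-image z z∉ fz∈ with ∈-map⁻ f fz∈
  ... | w , w∈ , eq with f-inj eq
  ...   | inj₁ refl = z∉ w∈
  ...   | inj₂ z∈   = z∉ z∈
  fx≢fy : f x ≢ f y
  fx≢fy eq = [ (λ x∉ → [ x≢y , x∉ ]′ (f-inj eq)) , (λ y∉ → [ x≢y ∘ sym , y∉ ]′ (f-inj (sym eq))) ]′ new

mutual
  Fresh⇒nullity≡0 : ∀ a {U} (R : List (Edge a)) → Fresh U R → nullity a R ≡ 0
  Fresh⇒nullity≡0 a []            []                  = refl
  Fresh⇒nullity≡0 a ((x , y) ∷ R) (cons x≢y _ fresh) = Fresh⇒nullity≡0′ a x y R (x ≟ y) x≢y fresh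

  Fresh⇒nullity≡0′ : ∀ a {U} x y (R : List (Edge a)) d → x ≢ y → Fresh (x ∷ y ∷ U) R → nullityAfter a x y R d ≡ 0
  Fresh⇒nullity≡0′ a       x y R (yes x≡y) x≢y _     = ⊥-elim (x≢y x≡y)
  Fresh⇒nullity≡0′ (suc a) x y R (no x≢y)  _   fresh =
    Fresh⇒nullity≡0 a (map (mapEdge (contract x y x≢y)) R) (Fresh-map (contract x y x≢y) collapse fresh)
    where
    collapse : ∀ {z w} → contract x y x≢y z ≡ contract x y x≢y w → z ≡ w ⊎ z ∈ x ∷ y ∷ _
    collapse eq with contract-collapse x y x≢y eq
    ... | inj₁ z≡w                = inj₁ z≡w
    ... | inj₂ (inj₁ (refl , _)) = inj₂ (here refl)
    ... | inj₂ (inj₂ (refl , _)) = inj₂ (there (here refl))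

Fresh⇒components+length≡size : ∀ a {U} (R : List (Edge a)) → Fresh U R → components a R ℕ.+ length R ≡ a
Fresh⇒components+length≡size a R fresh = begin
  components a R ℕ.+ length R ≡⟨ components+length≡size+nullity a R ⟩
  a ℕ.+ nullity a R          ≡⟨ cong (a ℕ.+_) (Fresh⇒nullity≡0 a R fresh) ⟩
  a ℕ.+ 0                    ≡⟨ ℕP.+-identityʳ a ⟩
  a                          ∎
  where open ≡-Reasoning

allSameColour≡0⊎1 : ∀ {a t} (R : List (Edge a)) (κ : Fin a → Fin t) →
                    allSameColour R κ ≡ 0 ⊎ (allSameColour R κ ≡ 1 × Monochromatic R κ)
allSameColour≡0⊎1 []            κ = inj₂ (refl , λ ())
allSameColour≡0⊎1 ((x , y) ∷ R) κ with κ x ≟ κ y | allSameColour≡0⊎1 R κ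
... | no _    | _                 = inj₁ refl
... | yes _   | inj₁ ≡0           = inj₁ (trans (ℕP.+-identityʳ _) ≡0)
... | yes κx≡κy | inj₂ (≡1 , mono) =
  inj₂ (trans (ℕP.+-identityʳ _) ≡1 , λ { (here refl) → κx≡κy ; (there e∈) → mono e∈ })

Monochromatic⇒allSameColour≡1 : ∀ {a t} (R : List (Edge a)) (κ : Fin a → Fin t) →
                                Monochromatic R κ → allSameColour R κ ≡ 1
Monochromatic⇒allSameColour≡1 []            κ mono = refl
Monochromatic⇒allSameColour≡1 ((x , y) ∷ R) κ mono rewrite dec-true (κ x ≟ κ y) (mono (here refl)) =
  trans (ℕP.+-identityʳ _) (Monochromatic⇒allSameColour≡1 R κ (mono ∘ there))

#monochromatic-mono : ∀ t a (S L : List (Edge a)) → (∀ (κ : Fin a → Fin t) → Monochromatic S κ → Monochromatic L κ) →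
                      #monochromatic t a S ≤ #monochromatic t a L
#monochromatic-mono t a S L S⇒L = ∑-mono (allFuns a t) pointwise
  where
  ∑-mono : ∀ {B : Set} (xs : List B) {f g : B → ℕ} → (∀ x → f x ≤ g x) → sum (map f xs) ≤ sum (map g xs)
  ∑-mono []       f≤g = z≤n
  ∑-mono (x ∷ xs) f≤g = ℕP.+-mono-≤ (f≤g x) (∑-mono xs f≤g)
  pointwise : ∀ κ → allSameColour S κ ≤ allSameColour L κ
  pointwise κ with allSameColour≡0⊎1 S κ
  ... | inj₁ ≡0          = ℕP.≤-trans (ℕP.≤-reflexive ≡0) z≤n
  ... | inj₂ (≡1 , mono) = ℕP.≤-reflexive (trans ≡1 (sym (Monochromatic⇒allSameColour≡1 L κ (S⇒L κ mono))))

-- 2 ^ components a S counts the 2-colourings that are constant on the edges of S.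
components-mono : ∀ a (S L : List (Edge a)) → (∀ (κ : Fin a → Fin 2) → Monochromatic S κ → Monochromatic L κ) →
                  components a S ≤ components a L
components-mono a S L S⇒L = ℕP.≮⇒≥ λ cL<cS → ℕP.<⇒≱ (ℕP.^-monoʳ-< 2 (s≤s (s≤s z≤n)) cL<cS) (begin
  2 ^ components a S     ≡⟨ #monochromatic≡^components 2 a S ⟨
  #monochromatic 2 a S   ≤⟨ #monochromatic-mono 2 a S L S⇒L ⟩
  #monochromatic 2 a L   ≡⟨ #monochromatic≡^components 2 a L ⟩
  2 ^ components a L     ∎)
  where open ℕP.≤-Reasoning

Joins⇒Monochromatic : ∀ {a t} {S L : List (Edge a)} → (∀ {e} → e ∈ L → Joins S (proj₁ e) (proj₂ e)) →
                      ∀ (κ : Fin a → Fin t) → Monochromatic S κ → Monochromatic L κ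
Joins⇒Monochromatic joins κ mono e∈ with joins e∈
... | inj₁ e∈S  = mono e∈S
... | inj₂ e′∈S = sym (mono e′∈S)

Fresh⇒components+length≤size : ∀ a (S L : List (Edge a)) → Fresh [] L →
                               (∀ {e} → e ∈ L → Joins S (proj₁ e) (proj₂ e)) → components a S ℕ.+ length L ≤ a
Fresh⇒components+length≤size a S L fresh joins = begin
  components a S ℕ.+ length L   ≤⟨ ℕP.+-monoˡ-≤ (length L) (components-mono a S L (Joins⇒Monochromatic joins)) ⟩
  components a L ℕ.+ length L   ≡⟨ Fresh⇒components+length≡size a L fresh ⟩
  a                             ∎
  where open ℕP.≤-Reasoning

pathEdges : ∀ {a} → Fin a → List (Fin a) → List (Edge a)
pathEdges x []       = []
pathEdges x (y ∷ vs) = (x , y) ∷ pathEdges y vs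

length-pathEdges : ∀ {a} (x : Fin a) vs → length (pathEdges x vs) ≡ length vs
length-pathEdges x []       = refl
length-pathEdges x (y ∷ vs) = cong suc (length-pathEdges y vs)

pathEdges-Fresh : ∀ {a} U (x : Fin a) vs → Unique (x ∷ vs) → (∀ {z} → z ∈ vs → z ∉ U) → Fresh U (pathEdges x vs)
pathEdges-Fresh U x []       _                   _     = []
pathEdges-Fresh U x (y ∷ vs) (x∉ ∷ y∉ ∷ uniq) new =
  cons (λ x≡y → x∉′ (here x≡y)) (inj₂ (new (here refl)))
       (pathEdges-Fresh (x ∷ y ∷ U) y vs (y∉ ∷ uniq) λ
          { z∈ (here refl)         → x∉′ (there z∈)
          ; z∈ (there (here refl)) → All.All¬⇒¬Any y∉ z∈
          ; z∈ (there (there z∈U)) → new (there z∈) z∈U })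
  where
  x∉′ : x ∉ y ∷ vs
  x∉′ = All.All¬⇒¬Any x∉

pathEdges-Joins : ∀ {a} {T : Fin a → Fin a → Set} {x vs} → Chain T x vs →
                  ∀ {e} → e ∈ pathEdges x vs → T (proj₁ e) (proj₂ e)
pathEdges-Joins (t ∷ c) (here refl) = t
pathEdges-Joins (t ∷ c) (there e∈)  = pathEdges-Joins c e∈

path⇒components+length≤size : ∀ a (S : List (Edge a)) x vs → Chain (Joins S) x vs → Unique (x ∷ vs) →
                              components a S ℕ.+ length vs ≤ a
path⇒components+length≤size a S x vs c uniq = subst (λ k → components a S ℕ.+ k ≤ a) (length-pathEdges x vs)
  (Fresh⇒components+length≤size a S (pathEdges x vs) (pathEdges-Fresh [] x vs uniq (λ _ ())) (pathEdges-Joins c))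

-- Edge sets of a graph with a shortest cycle

_≟ᵉ_ : ∀ {a} (e f : Edge a) → Dec (e ≡ f)
_≟ᵉ_ = ProductP.≡-dec _≟_ _≟_

_∈ᵉ?_ : ∀ {a} (e : Edge a) xs → Dec (e ∈ xs)
e ∈ᵉ? xs = DecMembership._∈?_ _≟ᵉ_ e xs

Unique-++⁻ˡ : ∀ {A : Set} (xs : List A) {ys} → Unique (xs ++ ys) → Unique xs
Unique-++⁻ˡ []       _          = []
Unique-++⁻ˡ (x ∷ xs) (x∉ ∷ u) = All.++⁻ˡ xs x∉ ∷ Unique-++⁻ˡ xs u

Unique-⊆⇒length≤ : ∀ {A : Set} {xs ys : List A} → Unique xs → xs ⊆ ys → length xs ≤ length ys
Unique-⊆⇒length≤ {xs = []}     _          _     = z≤n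
Unique-⊆⇒length≤ {xs = x ∷ xs} (x∉ ∷ u) xs⊆ys with ∈-∃++ (xs⊆ys (here refl))
... | A , B , refl = begin
  suc (length xs)       ≤⟨ s≤s (Unique-⊆⇒length≤ u λ z∈ →
                               remove A B (xs⊆ys (there z∈)) (λ { refl → All.All¬⇒¬Any x∉ z∈ })) ⟩
  suc (length (A ++ B)) ≡⟨ cong suc (ListP.length-++ A) ⟩
  suc (length A ℕ.+ length B) ≡⟨ ℕP.+-suc (length A) (length B) ⟨
  length A ℕ.+ length (x ∷ B) ≡⟨ ListP.length-++ A ⟨
  length (A ++ x ∷ B)   ∎
  where
  open ℕP.≤-Reasoning
  remove : ∀ {z} (A B : List _) → z ∈ A ++ x ∷ B → z ≢ x → z ∈ A ++ B
  remove []      B (here z≡x) z≢x = ⊥-elim (z≢x z≡x)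
  remove []      B (there z∈) z≢x = z∈
  remove (a ∷ A) B (here z≡a) z≢x = here z≡a
  remove (a ∷ A) B (there z∈) z≢x = there (remove A B z∈ z≢x)

normalise : ∀ {a} → Edge a → Edge a
normalise (p , q) = if toℕ p ℕ.<ᵇ toℕ q then (p , q) else (q , p)

normalise-< : ∀ {a} {p q : Fin a} → toℕ p < toℕ q → normalise (p , q) ≡ (p , q) × normalise (q , p) ≡ (p , q)
normalise-< {p = p} {q} p<q
  rewrite dec-true (toℕ p ℕ.<? toℕ q) p<q | dec-false (toℕ q ℕ.<? toℕ p) (ℕP.<⇒≯ p<q) = refl , refl

normalise-cases : ∀ {a} (p q : Fin a) → normalise (p , q) ≡ (p , q) ⊎ normalise (p , q) ≡ (q , p)
normalise-cases p q with toℕ p ℕ.<ᵇ toℕ q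
... | true  = inj₁ refl
... | false = inj₂ refl

normalise-injective : ∀ {a} {p q r s : Fin a} → normalise (p , q) ≡ normalise (r , s) →
                      (p ≡ r × q ≡ s) ⊎ (p ≡ s × q ≡ r)
normalise-injective {p = p} {q} {r} {s} eq with normalise-cases p q | normalise-cases r s
... | inj₁ e₁ | inj₁ e₂ = let e = trans (sym e₁) (trans eq e₂) in inj₁ (cong proj₁ e , cong proj₂ e)
... | inj₁ e₁ | inj₂ e₂ = let e = trans (sym e₁) (trans eq e₂) in inj₂ (cong proj₁ e , cong proj₂ e)
... | inj₂ e₁ | inj₁ e₂ = let e = trans (sym e₁) (trans eq e₂) in inj₂ (cong proj₂ e , cong proj₁ e)
... | inj₂ e₁ | inj₂ e₂ = let e = trans (sym e₁) (trans eq e₂) in inj₁ (cong proj₂ e , cong proj₁ e)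

normalise-∈edges : ∀ {n} (G : SimpleGraph n) {p q} → Adj G p q → normalise (p , q) ∈ edges G
normalise-∈edges G {p} {q} pq with ℕP.<-cmp (toℕ p) (toℕ q)
... | tri< p<q _ _ = subst (_∈ edges G) (sym (proj₁ (normalise-< p<q))) (∈-edges⁺ G p<q pq)
... | tri> _ _ q<p = subst (_∈ edges G) (sym (proj₂ (normalise-< q<p))) (∈-edges⁺ G q<p (trans (adj-sym G q p) pq))
... | tri≈ _ p≡q _ with toℕ-injective p≡q
...   | refl = case trans (sym pq) (irref G p) of λ ()

cycleEdges : ∀ {a} → Fin a → List (Fin a) → List (Edge a)
cycleEdges x vs = map normalise (pathEdges x vs ++ [ (end x vs , x) ])

length-cycleEdges : ∀ {a} (x : Fin a) vs → length (cycleEdges x vs) ≡ suc (length vs)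
length-cycleEdges x vs = begin
  length (cycleEdges x vs)                          ≡⟨ ListP.length-map normalise (pathEdges x vs ++ _) ⟩
  length (pathEdges x vs ++ [ (end x vs , x) ])     ≡⟨ ListP.length-++ (pathEdges x vs) ⟩
  length (pathEdges x vs) ℕ.+ 1                     ≡⟨ ℕP.+-comm (length (pathEdges x vs)) 1 ⟩
  suc (length (pathEdges x vs))                     ≡⟨ cong suc (length-pathEdges x vs) ⟩
  suc (length vs)                                   ∎
  where open ≡-Reasoning

pathEdges-endpoints : ∀ {a} (x : Fin a) vs {r s} → (r , s) ∈ pathEdges x vs → r ∈ x ∷ vs × s ∈ x ∷ vs
pathEdges-endpoints x (y ∷ vs) (here refl) = here refl , there (here refl)
pathEdges-endpoints x (y ∷ vs) (there rs∈) = Product.map there there (pathEdges-endpoints y vs rs∈)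

end-∈ : ∀ {a} (x : Fin a) vs → end x vs ∈ x ∷ vs
end-∈ x []       = here refl
end-∈ x (y ∷ vs) = there (end-∈ y vs)

cycleEdges-endpoints : ∀ {a} (x : Fin a) vs {e} → e ∈ cycleEdges x vs → proj₁ e ∈ x ∷ vs × proj₂ e ∈ x ∷ vs
cycleEdges-endpoints x vs e∈ with ∈-map⁻ normalise e∈
... | (r , s) , rs∈ , refl with endpoints (∈-++⁻ (pathEdges x vs) rs∈) | normalise-cases r s
  where
  endpoints : (r , s) ∈ pathEdges x vs ⊎ (r , s) ∈ [ (end x vs , x) ] → r ∈ x ∷ vs × s ∈ x ∷ vs
  endpoints (inj₁ rs∈′)        = pathEdges-endpoints x vs rs∈′
  endpoints (inj₂ (here refl)) = end-∈ x vs , here refl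
... | r∈ , s∈ | inj₁ eq rewrite eq = r∈ , s∈
... | r∈ , s∈ | inj₂ eq rewrite eq = s∈ , r∈

Unique-normalised-pathEdges : ∀ {a} (x : Fin a) vs → Unique (x ∷ vs) → Unique (map normalise (pathEdges x vs))
Unique-normalised-pathEdges x []       _          = []
Unique-normalised-pathEdges x (y ∷ vs) (x∉ ∷ u) = Unique-∷ new (Unique-normalised-pathEdges y vs u)
  where
  new : normalise (x , y) ∉ map normalise (pathEdges y vs)
  new e∈ with ∈-map⁻ normalise e∈
  ... | (r , s) , rs∈ , eq with pathEdges-endpoints y vs rs∈ | normalise-injective eq
  ...   | r∈ , _  | inj₁ (refl , _) = All.All¬⇒¬Any x∉ r∈
  ...   | _  , s∈ | inj₂ (refl , _) = All.All¬⇒¬Any x∉ s∈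

Unique-cycleEdges : ∀ {a} (x : Fin a) vs → Unique (x ∷ vs) → 2 ≤ length vs → Unique (cycleEdges x vs)
Unique-cycleEdges x vs uniq 2≤ = subst Unique (sym (ListP.map-++ normalise (pathEdges x vs) _))
  (Unique.++⁺ (Unique-normalised-pathEdges x vs uniq) ([] ∷ []) λ { (e∈ , here refl) → closing-new e∈ })
  where
  closing-new : normalise (end x vs , x) ∉ map normalise (pathEdges x vs)
  closing-new e∈ with ∈-map⁻ normalise e∈
  ... | (r , s) , rs∈ , eq = go vs uniq 2≤ rs∈ (normalise-injective (sym eq))
    where
    go : ∀ vs → Unique (x ∷ vs) → 2 ≤ length vs → (r , s) ∈ pathEdges x vs →
         (r ≡ end x vs × s ≡ x) ⊎ (r ≡ x × s ≡ end x vs) → ⊥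
    go (y ∷ [])       _             (s≤s ()) _ _
    go (y ∷ y′ ∷ vs′) (x∉ ∷ y∉ ∷ _) _ (here refl) (inj₁ (_ , refl)) = All.All¬⇒¬Any x∉ (here refl)
    go (y ∷ y′ ∷ vs′) (x∉ ∷ y∉ ∷ _) _ (here refl) (inj₂ (_ , e))    = All.All¬⇒¬Any y∉ (subst (_∈ y′ ∷ vs′) (sym e) (end-∈ y′ vs′))
    go (y ∷ vs′)      (x∉ ∷ _)      _ (there rs∈) (inj₁ (_ , refl)) = All.All¬⇒¬Any x∉ (proj₂ (pathEdges-endpoints y vs′ rs∈))
    go (y ∷ vs′)      (x∉ ∷ _)      _ (there rs∈) (inj₂ (refl , _)) = All.All¬⇒¬Any x∉ (proj₁ (pathEdges-endpoints y vs′ rs∈))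

forest-or-cycle : ∀ {n} (G : SimpleGraph n) {S} → S ∈ sublists (edges G) →
                  components n S ℕ.+ length S ≡ n
                  ⊎ n < components n S ℕ.+ length S × Σ[ x ∈ Fin n ] Σ[ vs ∈ List (Fin n) ] CycleList (Joins S) x vs
forest-or-cycle {n} G {S} S∈ with nullity n S in nullity≡ | components+length≡size+nullity n S
... | zero    | c+ℓ≡ = inj₁ (trans c+ℓ≡ (ℕP.+-identityʳ n))
... | suc k   | c+ℓ≡ = inj₂ (n<c+ℓ , nullity>0⇒cycle G S∈ (subst (0 <_) (sym nullity≡) (s≤s z≤n)))
  where
  n<c+ℓ : n < components n S ℕ.+ length S
  n<c+ℓ = subst (n <_) (sym c+ℓ≡) (ℕP.m<m+n n (s≤s z≤n))

acyclic⇒forest : ∀ {n} (G : SimpleGraph n) → Acyclic G →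
                 ∀ {S} → S ∈ sublists (edges G) → components n S ℕ.+ length S ≡ n
acyclic⇒forest G acyclic S∈ with forest-or-cycle G S∈
... | inj₁ forest           = forest
... | inj₂ (_ , x , vs , cycle) =
  ⊥-elim (acyclic _ (CycleList⇒HasCycleOfLength G (CycleList-map (Joins⇒Adj G (∈-sublists⇒⊆ (edges G) S∈)) cycle)))

record ShortestCycle {n} (G : SimpleGraph n) (g : ℕ) : Set where
  field
    shortest : ∀ {x vs} → CycleList (Adj G) x vs → g ≤ suc (length vs)
    x₀    : Fin n
    vs₀     : List (Fin n)
    length≡  : suc (length vs₀) ≡ g
    cycle    : CycleList (Adj G) x₀ vs₀

Chain-prefix : ∀ {a} {T : Fin a → Fin a → Set} {p} (M : List (Fin a)) {N} → Chain T p (M ++ N) → Chain T p M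
Chain-prefix []      c       = []
Chain-prefix (m ∷ M) (t ∷ c) = t ∷ Chain-prefix M c

end-snoc : ∀ {a} (p : Fin a) B q → end p (B ++ [ q ]) ≡ q
end-snoc p []      q = refl
end-snoc p (b ∷ B) q = end-snoc b B q

consecutive∈pathEdges : ∀ {a} (x : Fin a) vs (A : List (Fin a)) {p q B} →
                        x ∷ vs ≡ A ++ p ∷ q ∷ B → (p , q) ∈ pathEdges x vs
consecutive∈pathEdges x []       (_ ∷ [])    ()
consecutive∈pathEdges x []       (_ ∷ _ ∷ _) ()
consecutive∈pathEdges x (y ∷ vs) []      refl = here refl
consecutive∈pathEdges x (y ∷ vs) (_ ∷ A) eq   = there (consecutive∈pathEdges y vs A (ListP.∷-injectiveʳ eq))

sub-cycle : ∀ {n} (G : SimpleGraph n) {x vs} → CycleList (Adj G) x vs → ∀ A {p} M {q} B →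
            x ∷ vs ≡ A ++ p ∷ M ++ q ∷ B → Adj G q p → 0 < length M → CycleList (Adj G) p (M ++ [ q ])
sub-cycle G {x} {vs} (uniq , c , _ , _) A {p} M {q} B split qp 0<M =
  Unique-++⁻ˡ (p ∷ M ++ [ q ]) (Unique-++⁻ʳ A (subst Unique split′ uniq)) ,
  Chain-prefix (M ++ [ q ]) (Chain-suffix A c split′) ,
  subst (2 ≤_) (sym (trans (ListP.length-++ M) (ℕP.+-comm (length M) 1))) (s≤s 0<M) ,
  subst (λ z → Adj G z p) (sym (end-snoc p M q)) qp
  where
  split′ : x ∷ vs ≡ A ++ p ∷ (M ++ [ q ]) ++ B
  split′ = trans split (cong (λ z → A ++ p ∷ z) (sym (ListP.++-assoc M [ q ] B)))

Seen : ∀ {a} → List (Fin a) → List (Edge a) → List (Fin a)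
Seen U []            = U
Seen U ((x , y) ∷ R) = Seen (x ∷ y ∷ U) R

Fresh-++ : ∀ {a} {U : List (Fin a)} R {R′} → Fresh U R → Fresh (Seen U R) R′ → Fresh U (R ++ R′)
Fresh-++ []            []                  fresh′ = fresh′
Fresh-++ ((x , y) ∷ R) (cons x≢y new fresh) fresh′ = cons x≢y new (Fresh-++ R fresh fresh′)

Seen-pathEdges : ∀ {a} U (x : Fin a) vs {z} → z ∈ Seen U (pathEdges x vs) → z ∈ U ⊎ z ∈ x ∷ vs
Seen-pathEdges U x []       z∈ = inj₁ z∈
Seen-pathEdges U x (y ∷ vs) z∈ with Seen-pathEdges (x ∷ y ∷ U) y vs z∈
... | inj₁ (here refl)         = inj₂ (here refl)
... | inj₁ (there (here refl)) = inj₂ (there (here refl))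
... | inj₁ (there (there z∈U)) = inj₁ z∈U
... | inj₂ z∈vs                = inj₂ (there z∈vs)

⊆-or-∉ : ∀ {a} (S T : List (Edge a)) → S ⊆ T ⊎ Σ[ e ∈ Edge a ] e ∈ S × e ∉ T
⊆-or-∉ []      T = inj₁ λ ()
⊆-or-∉ (s ∷ S) T with s ∈ᵉ? T | ⊆-or-∉ S T
... | no s∉      | _                  = inj₂ (s , here refl , s∉)
... | yes s∈     | inj₁ S⊆T           = inj₁ λ { (here refl) → s∈ ; (there e∈) → S⊆T e∈ }
... | yes _      | inj₂ (e , e∈ , e∉) = inj₂ (e , there e∈ , e∉)

∈-filter-sublists : ∀ {A : Set} {P : A → Set} (P? : ∀ x → Dec (P x)) xs → filter P? xs ∈ sublists xs
∈-filter-sublists P? []       = here refl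
∈-filter-sublists P? (x ∷ xs) with does (P? x)
... | false = ∈-++⁺ˡ (∈-filter-sublists P? xs)
... | true  = ∈-++⁺ʳ (sublists xs) (∈-map⁺ (x ∷_) (∈-filter-sublists P? xs))

pathEdges-constant : ∀ {a t} (κ : Fin a → Fin t) x vs → Monochromatic (pathEdges x vs) κ →
                     ∀ {z} → z ∈ x ∷ vs → κ z ≡ κ x
pathEdges-constant κ x vs       mono (here refl) = refl
pathEdges-constant κ x (y ∷ vs) mono (there z∈)  =
  trans (pathEdges-constant κ y vs (mono ∘ there) z∈) (sym (mono (here refl)))

length-split : ∀ {A : Set} (A₁ : List A) p M q B →
               length (A₁ ++ p ∷ M ++ q ∷ B) ≡ suc (suc (length M ℕ.+ (length A₁ ℕ.+ length B)))
length-split A₁ p M q B = begin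
  length (A₁ ++ p ∷ M ++ q ∷ B)                      ≡⟨ ListP.length-++ A₁ ⟩
  a ℕ.+ suc (length (M ++ q ∷ B))                    ≡⟨ cong (λ k → a ℕ.+ suc k) (ListP.length-++ M) ⟩
  a ℕ.+ suc (m ℕ.+ suc c)                            ≡⟨ cong (λ k → a ℕ.+ suc k) (ℕP.+-suc m c) ⟩
  a ℕ.+ suc (suc (m ℕ.+ c))                          ≡⟨ ℕP.+-suc a (suc (m ℕ.+ c)) ⟩
  suc (a ℕ.+ suc (m ℕ.+ c))                          ≡⟨ cong suc (ℕP.+-suc a (m ℕ.+ c)) ⟩
  suc (suc (a ℕ.+ (m ℕ.+ c)))                        ≡⟨ cong (λ k → suc (suc k)) (ℕP.+-assoc a m c) ⟨
  suc (suc ((a ℕ.+ m) ℕ.+ c))                        ≡⟨ cong (λ k → suc (suc (k ℕ.+ c))) (ℕP.+-comm a m) ⟩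
  suc (suc ((m ℕ.+ a) ℕ.+ c))                        ≡⟨ cong (λ k → suc (suc k)) (ℕP.+-assoc m a c) ⟩
  suc (suc (m ℕ.+ (a ℕ.+ c)))                        ∎
  where
  open ≡-Reasoning
  a = length A₁
  m = length M
  c = length B

path+edge⇒components+length≤size : ∀ a (S : List (Edge a)) x vs → Chain (Joins S) x vs → Unique (x ∷ vs) →
  ∀ {p q} → (p , q) ∈ S → p ≢ q → p ∉ x ∷ vs ⊎ q ∉ x ∷ vs → components a S ℕ.+ suc (length vs) ≤ a
path+edge⇒components+length≤size a S x vs c uniq {p} {q} pq∈ p≢q new = subst (λ k → components a S ℕ.+ k ≤ a) length≡
  (Fresh⇒components+length≤size a S L
    (Fresh-++ (pathEdges x vs) (pathEdges-Fresh [] x vs uniq (λ _ ())) (cons p≢q (Sum.map unseen unseen new) []))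
    joins)
  where
  L = pathEdges x vs ++ [ (p , q) ]
  unseen : ∀ {z} → z ∉ x ∷ vs → z ∉ Seen [] (pathEdges x vs)
  unseen z∉ z∈ with Seen-pathEdges [] x vs z∈
  ... | inj₂ z∈′ = z∉ z∈′
  joins : ∀ {e} → e ∈ L → Joins S (proj₁ e) (proj₂ e)
  joins e∈ with ∈-++⁻ (pathEdges x vs) e∈
  ... | inj₁ e∈P         = pathEdges-Joins c e∈P
  ... | inj₂ (here refl) = inj₁ pq∈
  length≡ : length L ≡ suc (length vs)
  length≡ = trans (ListP.length-++ (pathEdges x vs)) (trans (ℕP.+-comm (length (pathEdges x vs)) 1) (cong suc (length-pathEdges x vs)))

module _ {n} (G : SimpleGraph n) {g} (sc : ShortestCycle G g) where
  open ShortestCycle sc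

  cycle⇒components+girth≤ : ∀ {S} → S ∈ sublists (edges G) → ∀ {x vs} → CycleList (Joins S) x vs →
                             components n S ℕ.+ g ≤ suc n
  cycle⇒components+girth≤ {S} S∈ {x} {vs} cyc@(uniq , c , _ , _) = begin
    components n S ℕ.+ g                  ≤⟨ ℕP.+-monoʳ-≤ (components n S)
                                               (shortest (CycleList-map (Joins⇒Adj G (∈-sublists⇒⊆ (edges G) S∈)) cyc)) ⟩
    components n S ℕ.+ suc (length vs)    ≡⟨ ℕP.+-suc (components n S) (length vs) ⟩
    suc (components n S ℕ.+ length vs)    ≤⟨ s≤s (path⇒components+length≤size n S x vs c uniq) ⟩
    suc n                                 ∎
    where open ℕP.≤-Reasoning

  short⇒forest : ∀ {S} → S ∈ sublists (edges G) → length S < g → components n S ℕ.+ length S ≡ n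
  short⇒forest {S} S∈ ℓ<g with forest-or-cycle G S∈
  ... | inj₁ forest           = forest
  ... | inj₂ (n<c+ℓ , x , vs , cycle) = ⊥-elim (ℕP.<-irrefl refl (begin-strict
    suc n                                 ≤⟨ n<c+ℓ ⟩
    components n S ℕ.+ length S           <⟨ ℕP.+-monoʳ-< (components n S) ℓ<g ⟩
    components n S ℕ.+ g                  ≤⟨ cycle⇒components+girth≤ S∈ cycle ⟩
    suc n                                 ∎))
    where open ℕP.≤-Reasoning

  long⇒components+girth≤ : ∀ {S} → S ∈ sublists (edges G) → g ≤ length S → components n S ℕ.+ g ≤ suc n
  long⇒components+girth≤ {S} S∈ g≤ℓ with forest-or-cycle G S∈
  ... | inj₁ forest                =
    ℕP.m≤n⇒m≤1+n (ℕP.≤-trans (ℕP.+-monoʳ-≤ (components n S) g≤ℓ) (ℕP.≤-reflexive forest))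
  ... | inj₂ (_ , x , vs , cycle) = cycle⇒components+girth≤ S∈ cycle

  cycle+pendant⇒components+girth≤size : ∀ {S} → S ∈ sublists (edges G) →
    ∀ {x vs} → CycleList (Joins S) x vs → g ≡ suc (length vs) →
            ∀ {p q} → (p , q) ∈ S → p ∉ x ∷ vs ⊎ q ∉ x ∷ vs → components n S ℕ.+ g ≤ n
  cycle+pendant⇒components+girth≤size {S} S∈ {x} {vs} (uniq , c , _ , _) g≡ {p} {q} pq∈ new =
    subst (λ k → components n S ℕ.+ k ≤ n) (sym g≡) (path+edge⇒components+length≤size n S x vs c uniq pq∈ p≢q new)
    where
    p≢q : p ≢ q
    p≢q p≡q = ℕP.<-irrefl (cong toℕ p≡q) (proj₁ (∈-edges⁻ G (∈-sublists⇒⊆ (edges G) S∈ pq∈)))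

  inner-chord⇒⊥ : ∀ {x vs} → CycleList (Adj G) x vs → g ≡ suc (length vs) → ∀ A {p} M {q} B →
                  x ∷ vs ≡ A ++ p ∷ M ++ q ∷ B → Adj G q p → 0 < length M → 0 < length A ℕ.+ length B → ⊥
  inner-chord⇒⊥ {x} {vs} cyc g≡ A {p} M {q} B split qp 0<M 0<A+B = ℕP.<-irrefl refl (begin-strict
    g                                                ≤⟨ shortest (sub-cycle G cyc A M B split qp 0<M) ⟩
    suc (length (M ++ [ q ]))                        ≡⟨ cong suc (trans (ListP.length-++ M) (ℕP.+-comm (length M) 1)) ⟩
    suc (suc (length M))                             <⟨ s≤s (s≤s (ℕP.m<m+n (length M) 0<A+B)) ⟩
    suc (suc (length M ℕ.+ (length A ℕ.+ length B))) ≡⟨ length-split A p M q B ⟨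
    length (A ++ p ∷ M ++ q ∷ B)                     ≡⟨ cong length split ⟨
    suc (length vs)                                  ≡⟨ g≡ ⟨
    g                                                ∎)
    where open ℕP.≤-Reasoning

  chord⇒⊥ : ∀ {x vs} → CycleList (Adj G) x vs → g ≡ suc (length vs) → ∀ {e} → e ∉ cycleEdges x vs →
            ∀ A p M q B → x ∷ vs ≡ A ++ p ∷ M ++ q ∷ B →
            normalise (p , q) ≡ e → normalise (q , p) ≡ e → Adj G q p → ⊥
  chord⇒⊥ {x} {vs} cyc g≡ e∉ A p [] q B split pq≡e _ qp =
    e∉ (subst (_∈ cycleEdges x vs) pq≡e (∈-map⁺ normalise (∈-++⁺ˡ (consecutive∈pathEdges x vs A split))))
  chord⇒⊥ {x} {vs} cyc g≡ e∉ [] p (m ∷ M) q [] split _ qp≡e qp =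
    e∉ (subst (_∈ cycleEdges x vs) (trans (cong₂ (λ r s → normalise (r , s)) end≡q x≡p) qp≡e)
              (∈-map⁺ normalise (∈-++⁺ʳ (pathEdges x vs) (here refl))))
    where
    x≡p : x ≡ p
    x≡p = ListP.∷-injectiveˡ split
    end≡q : end x vs ≡ q
    end≡q = trans (cong (end x) (ListP.∷-injectiveʳ split)) (end-snoc x (m ∷ M) q)
  chord⇒⊥ cyc g≡ e∉ A@(_ ∷ _) p M@(_ ∷ _) q B split _ _ qp =
    inner-chord⇒⊥ cyc g≡ A M B split qp (s≤s z≤n) (s≤s z≤n)
  chord⇒⊥ cyc g≡ e∉ [] p M@(_ ∷ _) q B@(_ ∷ _) split _ _ qp =
    inner-chord⇒⊥ cyc g≡ [] M B split qp (s≤s z≤n) (s≤s z≤n)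

  -- A chord of a shortest cycle would close a shorter cycle.
  ends-on-cycle⇒cycle-edge : ∀ {x vs} → CycleList (Adj G) x vs → g ≡ suc (length vs) →
                             ∀ {a b} → toℕ a < toℕ b → Adj G a b →
                             a ∈ x ∷ vs → b ∈ x ∷ vs → (a , b) ∈ cycleEdges x vs
  ends-on-cycle⇒cycle-edge {x} {vs} cyc g≡ {a} {b} a<b ab a∈ b∈ with (a , b) ∈ᵉ? cycleEdges x vs
  ... | yes ab∈cycle = ab∈cycle
  ... | no ab∉cycle with ∈-∃++ a∈
  ...   | A₁ , R₁ , split with ∈-++⁻ A₁ (subst (b ∈_) split b∈)
  ...     | inj₂ (here b≡a) = ⊥-elim (ℕP.<-irrefl (cong toℕ (sym b≡a)) a<b)
  ...     | inj₂ (there b∈R₁) with ∈-∃++ b∈R₁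
  ...       | M , B , refl = ⊥-elim (chord⇒⊥ cyc g≡ ab∉cycle A₁ a M b B split
                                     (proj₁ (normalise-< a<b)) (proj₂ (normalise-< a<b)) (trans (adj-sym G b a) ab))
  ends-on-cycle⇒cycle-edge {x} {vs} cyc g≡ {a} {b} a<b ab a∈ b∈ | no ab∉cycle | A₁ , R₁ , split | inj₁ b∈A₁
    with ∈-∃++ b∈A₁
  ... | A , M , refl = ⊥-elim (chord⇒⊥ cyc g≡ ab∉cycle A b M a R₁ (trans split (ListP.++-assoc A (b ∷ M) (a ∷ R₁)))
                                 (proj₂ (normalise-< a<b)) (proj₁ (normalise-< a<b)) ab)

  tight-cycle⇒components+girth≤size : ∀ {S} → S ∈ sublists (edges G) → g < length S →
    ∀ {x vs} → CycleList (Joins S) x vs → g ≡ suc (length vs) → components n S ℕ.+ g ≤ n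
  tight-cycle⇒components+girth≤size {S} S∈ g<ℓ {x} {vs} cyc@(uniq , c , _ , _) g≡ with ⊆-or-∉ S (cycleEdges x vs)
  ... | inj₁ S⊆cycle = ⊥-elim (ℕP.<-irrefl refl (begin-strict
    g                         <⟨ g<ℓ ⟩
    length S                  ≤⟨ Unique-⊆⇒length≤ (∈-sublists⇒Unique (edges G) (Unique-edges G) S∈) S⊆cycle ⟩
    length (cycleEdges x vs)  ≡⟨ length-cycleEdges x vs ⟩
    suc (length vs)           ≡⟨ g≡ ⟨
    g                         ∎))
    where open ℕP.≤-Reasoning
  ... | inj₂ ((a , b) , ab∈S , ab∉cycle) with a ∈ᶠ? (x ∷ vs) | b ∈ᶠ? (x ∷ vs)
  ...   | yes a∈ | yes b∈ = ⊥-elim (ab∉cycle (ends-on-cycle⇒cycle-edge (CycleList-map (Joins⇒Adj G S⊆E) cyc) g≡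
                                          (proj₁ (∈-edges⁻ G (S⊆E ab∈S))) (proj₂ (∈-edges⁻ G (S⊆E ab∈S))) a∈ b∈))
    where S⊆E = ∈-sublists⇒⊆ (edges G) S∈
  ...   | no a∉  | _      = cycle+pendant⇒components+girth≤size S∈ cyc g≡ ab∈S (inj₁ a∉)
  ...   | yes _  | no b∉  = cycle+pendant⇒components+girth≤size S∈ cyc g≡ ab∈S (inj₂ b∉)

  longer⇒components+girth≤size : ∀ {S} → S ∈ sublists (edges G) → g < length S → components n S ℕ.+ g ≤ n
  longer⇒components+girth≤size {S} S∈ g<ℓ with forest-or-cycle G S∈
  ... | inj₁ forest = ℕP.<⇒≤ (ℕP.<-≤-trans (ℕP.+-monoʳ-< (components n S) g<ℓ) (ℕP.≤-reflexive forest))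
  ... | inj₂ (_ , x , vs , cyc@(uniq , c , _ , _)) with g ℕP.≤? length vs
  ...   | yes g≤vs = ℕP.≤-trans (ℕP.+-monoʳ-≤ (components n S) g≤vs) (path⇒components+length≤size n S x vs c uniq)
  ...   | no g≰vs  = tight-cycle⇒components+girth≤size S∈ g<ℓ cyc
                       (ℕP.≤-antisym (shortest (CycleList-map (Joins⇒Adj G (∈-sublists⇒⊆ (edges G) S∈)) cyc))
                                     (ℕP.≰⇒> g≰vs))

  shortest-cycle-edges : Σ[ S ∈ List (Edge n) ] S ∈ sublists (edges G) × length S ≡ g × components n S ℕ.+ g ≡ suc n
  shortest-cycle-edges = S , S∈ , length-S , ℕP.≤-antisym (long⇒components+girth≤ S∈ (ℕP.≤-reflexive (sym length-S))) lower
    where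
    E₀ = cycleEdges x₀ vs₀
    uniq = proj₁ cycle
    c = proj₁ (proj₂ cycle)
    S = filter (_∈ᵉ? E₀) (edges G)
    S∈ : S ∈ sublists (edges G)
    S∈ = ∈-filter-sublists (_∈ᵉ? E₀) (edges G)
    S⊆E₀ : S ⊆ E₀
    S⊆E₀ e∈ = proj₂ (∈-filter⁻ (_∈ᵉ? E₀) {xs = edges G} e∈)
    E₀⊆S : E₀ ⊆ S
    E₀⊆S e∈ = ∈-filter⁺ (_∈ᵉ? E₀) (E₀⊆E e∈) e∈
      where
      E₀⊆E : E₀ ⊆ edges G
      E₀⊆E e∈ with ∈-map⁻ normalise e∈
      ... | (r , s) , rs∈ , refl with ∈-++⁻ (pathEdges x₀ vs₀) rs∈
      ...   | inj₁ rs∈P        = normalise-∈edges G (pathEdges-Joins c rs∈P)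
      ...   | inj₂ (here refl) = normalise-∈edges G (proj₂ (proj₂ (proj₂ cycle)))
    length-S : length S ≡ g
    length-S = ℕP.≤-antisym
      (ℕP.≤-trans (Unique-⊆⇒length≤ (Unique.filter⁺ (_∈ᵉ? E₀) (Unique-edges G)) S⊆E₀)
                  (ℕP.≤-reflexive (trans (length-cycleEdges x₀ vs₀) length≡)))
      (ℕP.≤-trans (ℕP.≤-reflexive (sym (trans (length-cycleEdges x₀ vs₀) length≡)))
                  (Unique-⊆⇒length≤ (Unique-cycleEdges x₀ vs₀ uniq (proj₁ (proj₂ (proj₂ cycle)))) E₀⊆S))
    P = pathEdges x₀ vs₀
    P⇒S : ∀ (κ : Fin n → Fin 2) → Monochromatic P κ → Monochromatic S κ
    P⇒S κ mono e∈ = let r∈ , s∈ = cycleEdges-endpoints x₀ vs₀ (S⊆E₀ e∈) in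
      trans (pathEdges-constant κ x₀ vs₀ mono r∈) (sym (pathEdges-constant κ x₀ vs₀ mono s∈))
    lower : suc n ≤ components n S ℕ.+ g
    lower = begin
      suc n                                  ≡⟨ cong suc (Fresh⇒components+length≡size n P
                                                   (pathEdges-Fresh [] x₀ vs₀ uniq (λ _ ()))) ⟨
      suc (components n P ℕ.+ length P)      ≡⟨ cong (λ k → suc (components n P ℕ.+ k)) (length-pathEdges x₀ vs₀) ⟩
      suc (components n P ℕ.+ length vs₀)   ≡⟨ ℕP.+-suc (components n P) (length vs₀) ⟨
      components n P ℕ.+ suc (length vs₀)   ≤⟨ ℕP.+-mono-≤ (components-mono n P S P⇒S) (ℕP.≤-reflexive length≡) ⟩
      components n S ℕ.+ g                   ∎
      where open ℕP.≤-Reasoning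

allFuns-complete : ∀ a b (f : Fin a → Fin b) → Any (f ≗_) (allFuns a b)
allFuns-complete zero    b f = here (λ ())
allFuns-complete (suc a) b f = AnyP.concat⁺ (AnyP.map⁺ (lose (∈-allFin (f zero))
  (AnyP.map⁺ (Any.map (λ f∘suc≗f′ → λ { zero → refl ; (suc i) → f∘suc≗f′ i }) (allFuns-complete a b (f ∘ suc))))))

module _ {n} (G : SimpleGraph n) where

  IsCycle-resp : ∀ h {f f′ : Fin (suc h) → Fin n} → f ≗ f′ → IsCycle G h f → IsCycle G h f′
  IsCycle-resp h f≗f′ (2≤h , f-inj , steps , closing) =
    2≤h , (λ {i} {j} eq → f-inj (trans (f≗f′ i) (trans eq (sym (f≗f′ j))))) ,
    (λ i → subst₂ (Adj G) (f≗f′ (inject₁ i)) (f≗f′ (suc i)) (steps i)) ,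
    subst₂ (Adj G) (f≗f′ (fromℕ h)) (f≗f′ zero) closing

  IsCycle? : ∀ h f → Dec (IsCycle G h f)
  IsCycle? h f = (2 ℕP.≤? h) ×-dec injective? ×-dec
                 FinP.all? (λ i → adj G (f (inject₁ i)) (f (suc i)) BoolP.≟ true) ×-dec
                 (adj G (f (fromℕ h)) (f zero) BoolP.≟ true)
    where
    injective? : Dec (∀ {i j} → f i ≡ f j → i ≡ j)
    injective? = map′ (λ inj {i} {j} → inj i j) (λ inj i j → inj)
                      (FinP.all? λ i → FinP.all? λ j → (f i ≟ f j) →-dec (i ≟ j))

  HasCycleOfLength? : ∀ L → Dec (HasCycleOfLength G L)
  HasCycleOfLength? zero    = no λ ()
  HasCycleOfLength? (suc h) with any? (IsCycle? h) (allFuns (suc h) n)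
  ... | yes found = let f , _ , cyc = find found in yes (f , cyc)
  ... | no none   = no λ { (f , cyc) → none (Any.map (λ f≗f′ → IsCycle-resp h f≗f′ cyc) (allFuns-complete (suc h) n f)) }

  HasCycleOfLength⇒≤size : ∀ L → HasCycleOfLength G L → L ≤ n
  HasCycleOfLength⇒≤size (suc h) (f , _ , f-inj , _) = FinP.injective⇒≤ f-inj

  private
    shortest-below : ∀ B → (∀ L → L < B → ¬ HasCycleOfLength G L) ⊎ Σ ℕ (GirthIs G)
    shortest-below zero    = inj₁ λ _ ()
    shortest-below (suc B) with shortest-below B
    ... | inj₂ girth = inj₂ girth
    ... | inj₁ none with HasCycleOfLength? B
    ...   | yes cyc = inj₂ (B , cyc , none)
    ...   | no ¬cyc = inj₁ λ L L<1+B → case ℕP.m≤n⇒m<n∨m≡n (ℕP.≤-pred L<1+B) of λ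
                        { (inj₁ L<B) → none L L<B
                        ; (inj₂ refl) → ¬cyc }

  acyclic-or-girth : Acyclic G ⊎ Σ[ h ∈ ℕ ] GirthIs G (suc h)
  acyclic-or-girth with shortest-below (suc n)
  ... | inj₁ none                = inj₁ λ L cyc → none L (s≤s (HasCycleOfLength⇒≤size L cyc)) cyc
  ... | inj₂ (zero , () , _)
  ... | inj₂ (suc h , girth)     = inj₂ (h , girth)

  girth⇒ShortestCycle : ∀ {h} → GirthIs G (suc h) → ShortestCycle G (suc h) × h < n
  girth⇒ShortestCycle {h} (cyc , minimal) with HasCycleOfLength⇒CycleList G h cyc
  ... | x , vs , length≡h , cycle =
    record { shortest = λ cyc′ → ℕP.≮⇒≥ λ shorter → minimal _ shorter (CycleList⇒HasCycleOfLength G cyc′)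
           ; x₀ = x ; vs₀ = vs ; length≡ = cong suc length≡h ; cycle = cycle } ,
    HasCycleOfLength⇒≤size (suc h) cyc

-- The coefficients of Whitney's expansion

#sublists-of-length : ∀ {A : Set} (xs : List A) j →
                      sum (map (λ S → if length S ℕ.≡ᵇ j then 1 else 0) (sublists xs)) ≡ length xs C j
#sublists-of-length []       zero    = refl
#sublists-of-length []       (suc j) = refl
#sublists-of-length (x ∷ xs) j = begin
  sum (map ind (sublists xs ++ map (x ∷_) (sublists xs)))              ≡⟨ ∑ℕ.∑-map-++ ind (sublists xs) (map (x ∷_) (sublists xs)) ⟩
  sum (map ind (sublists xs)) ℕ.+ sum (map ind (map (x ∷_) (sublists xs)))
                                                                       ≡⟨ cong₂ ℕ._+_ (#sublists-of-length xs j) (cong sum (sym (ListP.map-∘ (sublists xs)))) ⟩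
  length xs C j ℕ.+ sum (map (λ S → if suc (length S) ℕ.≡ᵇ j then 1 else 0) (sublists xs))
                                                                       ≡⟨ Pascal j ⟩
  suc (length xs) C j                                                  ∎
  where
  open ≡-Reasoning
  ind : List _ → ℕ
  ind S = if length S ℕ.≡ᵇ j then 1 else 0
  Pascal : ∀ j → length xs C j ℕ.+ sum (map (λ S → if suc (length S) ℕ.≡ᵇ j then 1 else 0) (sublists xs))
                 ≡ suc (length xs) C j
  Pascal zero    = cong (1 ℕ.+_) (∑ℕ.∑-zero (sublists xs) (λ _ _ → refl))
  Pascal (suc j) = trans (cong (length xs C suc j ℕ.+_) (#sublists-of-length xs j))
                         (trans (ℕP.+-comm (length xs C suc j) (length xs C j)) (nCk+nC[k+1]≡[n+1]C[k+1] (length xs) j))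

∑-if : ∀ {B : Set} (p : B → Bool) (a : ℚ) xs →
       sumℚ (map (λ x → if p x then a else 0ℚ) xs) ≡ ℕ→ℚ (sum (map (λ x → if p x then 1 else 0) xs)) * a
∑-if p a xs = begin
  sumℚ (map (λ x → if p x then a else 0ℚ) xs)                     ≡⟨ ∑ℚ.∑-cong′ xs pointwise ⟩
  sumℚ (map (λ x → a * ℕ→ℚ (if p x then 1 else 0)) xs)            ≡⟨ ∑ℚ.*-∑ a (λ x → ℕ→ℚ (if p x then 1 else 0)) xs ⟨
  a * sumℚ (map (λ x → ℕ→ℚ (if p x then 1 else 0)) xs)            ≡⟨ cong (a *_) (ℕ→ℚ-sum (λ x → if p x then 1 else 0) xs) ⟨
  a * ℕ→ℚ (sum (map (λ x → if p x then 1 else 0) xs))             ≡⟨ ℚP.*-comm a _ ⟩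
  ℕ→ℚ (sum (map (λ x → if p x then 1 else 0) xs)) * a             ∎
  where
  open ≡-Reasoning
  pointwise : ∀ x → (if p x then a else 0ℚ) ≡ a * ℕ→ℚ (if p x then 1 else 0)
  pointwise x with p x
  ... | true  = sym (ℚP.*-identityʳ a)
  ... | false = sym (ℚP.*-zeroʳ a)

∑-sublists-of-length : ∀ {A : Set} (xs : List A) j (a : ℚ) →
  sumℚ (map (λ S → if length S ℕ.≡ᵇ j then a else 0ℚ) (sublists xs)) ≡ ℕ→ℚ (length xs C j) * a
∑-sublists-of-length xs j a =
  trans (∑-if (λ S → length S ℕ.≡ᵇ j) a (sublists xs)) (cong (λ z → ℕ→ℚ z * a) (#sublists-of-length xs j))

edgeCount≡length-edges : ∀ {n} (G : SimpleGraph n) → edgeCount G ≡ length (edges G)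
edgeCount≡length-edges {n} G = sym (begin
  length (edges G)                                               ≡⟨ length-concatMap (allFin n) ⟩
  sum (map (λ u → length (map (u ,_) (upNeighbours G u))) (allFin n))       ≡⟨ ∑ℕ.∑-cong′ (allFin n) (λ u → ListP.length-map (u ,_) (upNeighbours G u)) ⟩
  sum (map (λ u → length (upNeighbours G u)) (allFin n))                    ∎)
  where
  open ≡-Reasoning
  length-concatMap : ∀ {A B : Set} {f : A → List B} xs → length (concatMap f xs) ≡ sum (map (length ∘ f) xs)
  length-concatMap         []       = refl
  length-concatMap {f = f} (x ∷ xs) = trans (ListP.length-++ (f x)) (cong (length (f x) ℕ.+_) (length-concatMap xs))

≡ᵇ-resp-⇔ : ∀ a b c d → (a ≡ b → c ≡ d) → (c ≡ d → a ≡ b) → (a ℕ.≡ᵇ b) ≡ (c ℕ.≡ᵇ d)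
≡ᵇ-resp-⇔ a b c d to from with a ℕ.≟ b
... | yes a≡b = trans (dec-true (a ℕ.≟ b) a≡b) (sym (dec-true (c ℕ.≟ d) (to a≡b)))
... | no a≢b  = trans (dec-false (a ℕ.≟ b) a≢b) (sym (dec-false (c ℕ.≟ d) (a≢b ∘ from)))

if-≡ᵇ : ∀ a b (x : ℕ → ℚ) → (if a ℕ.≡ᵇ b then x a else 0ℚ) ≡ (if a ℕ.≡ᵇ b then x b else 0ℚ)
if-≡ᵇ a b x with a ℕ.≟ b
... | yes refl = refl
... | no a≢b   = trans (cong (λ c → if c then x a else 0ℚ) ≡false) (sym (cong (λ c → if c then x b else 0ℚ) ≡false))
  where
  ≡false : (a ℕ.≡ᵇ b) ≡ false
  ≡false = dec-false (a ℕ.≟ b) a≢b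

forest⇒≡ᵇ : ∀ c s {n} k → c ℕ.+ s ≡ n → k ≤ n → (c ℕ.≡ᵇ k) ≡ (s ℕ.≡ᵇ n ∸ k)
forest⇒≡ᵇ c s k refl k≤n = ≡ᵇ-resp-⇔ c k s (c ℕ.+ s ∸ k) (λ { refl → sym (ℕP.m+n∸m≡n c s) })
  (λ s≡ → trans (sym (ℕP.m+n∸n≡m c s)) (trans (cong (c ℕ.+ s ∸_) s≡) (ℕP.m∸[m∸n]≡n k≤n)))

m∸n+1+n≡1+m : ∀ {m n} → n ≤ m → m ∸ n ℕ.+ suc n ≡ suc m
m∸n+1+n≡1+m {m} {n} n≤m = trans (ℕP.+-suc (m ∸ n) n) (cong suc (ℕP.m∸n+n≡m n≤m))

signedBinom-≤ : ∀ {n k} m → k ≤ n → signedBinom n m k ≡ signℚ (n ∸ k) * ℕ→ℚ (m C (n ∸ k))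
signedBinom-≤ {n} {k} m k≤n =
  cong (λ b → if b then signℚ (n ∸ k) * ℕ→ℚ (m C (n ∸ k)) else 0ℚ) (dec-true (k ℕ.≤? n) k≤n)

module _ {n} (G : SimpleGraph n) where

  private
    term : ℕ → List (Edge n) → ℚ
    term k S = if components n S ℕ.≡ᵇ k then signℚ (length S) else 0ℚ

  whitney≡signedBinom : ∀ {k} → k ≤ n →
    (∀ {S} → S ∈ sublists (edges G) → (components n S ℕ.≡ᵇ k) ≡ (length S ℕ.≡ᵇ n ∸ k)) →
    whitney G k ≡ signedBinom n (edgeCount G) k
  whitney≡signedBinom {k} k≤n agree = begin
    whitney G k
      ≡⟨ ∑ℚ.∑-cong (sublists (edges G)) (λ S S∈ → trans (cong (λ b → if b then signℚ (length S) else 0ℚ) (agree S∈))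
                                                        (if-≡ᵇ (length S) (n ∸ k) signℚ)) ⟩
    sumℚ (map (λ S → if length S ℕ.≡ᵇ n ∸ k then signℚ (n ∸ k) else 0ℚ) (sublists (edges G)))
      ≡⟨ ∑-sublists-of-length (edges G) (n ∸ k) (signℚ (n ∸ k)) ⟩
    ℕ→ℚ (length (edges G) C (n ∸ k)) * signℚ (n ∸ k)
      ≡⟨ ℚP.*-comm _ (signℚ (n ∸ k)) ⟩
    signℚ (n ∸ k) * ℕ→ℚ (length (edges G) C (n ∸ k))
      ≡⟨ cong (λ m → signℚ (n ∸ k) * ℕ→ℚ (m C (n ∸ k))) (edgeCount≡length-edges G) ⟨
    signℚ (n ∸ k) * ℕ→ℚ (edgeCount G C (n ∸ k))
      ≡⟨ signedBinom-≤ (edgeCount G) k≤n ⟨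
    signedBinom n (edgeCount G) k ∎
    where open ≡-Reasoning

  acyclic⇒whitney≡signedBinom : Acyclic G → ∀ {k} → k ≤ n → whitney G k ≡ signedBinom n (edgeCount G) k
  acyclic⇒whitney≡signedBinom acyclic {k} k≤n =
    whitney≡signedBinom k≤n (λ {S} S∈ → forest⇒≡ᵇ (components n S) (length S) k (acyclic⇒forest G acyclic S∈) k≤n)

  module _ {g} (sc : ShortestCycle G g) where

    above-girth⇒whitney≡signedBinom : ∀ {k} → k ≤ n → suc n < k ℕ.+ g → whitney G k ≡ signedBinom n (edgeCount G) k
    above-girth⇒whitney≡signedBinom {k} k≤n n<k+g = whitney≡signedBinom k≤n agree
      where
      agree : ∀ {S} → S ∈ sublists (edges G) → (components n S ℕ.≡ᵇ k) ≡ (length S ℕ.≡ᵇ n ∸ k)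
      agree {S} S∈ with length S ℕ.<? g
      ... | yes ℓ<g = forest⇒≡ᵇ (components n S) (length S) k (short⇒forest G sc S∈ ℓ<g) k≤n
      ... | no ℓ≮g  = ≡ᵇ-resp-⇔ (components n S) k (length S) (n ∸ k)
                           (λ { refl → ⊥-elim (ℕP.<-irrefl refl (ℕP.<-≤-trans n<k+g bound)) })
                           (λ ℓ≡ → ⊥-elim (ℕP.<-irrefl refl (ℕP.<-≤-trans n<k+g (begin
                             k ℕ.+ g            ≤⟨ ℕP.+-monoʳ-≤ k (ℕP.≮⇒≥ ℓ≮g) ⟩
                             k ℕ.+ length S     ≡⟨ cong (k ℕ.+_) ℓ≡ ⟩
                             k ℕ.+ (n ∸ k)      ≡⟨ ℕP.m+[n∸m]≡n k≤n ⟩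
                             n                  ≤⟨ ℕP.n≤1+n n ⟩
                             suc n              ∎))))
        where
        open ℕP.≤-Reasoning
        bound : components n S ℕ.+ g ≤ suc n
        bound = long⇒components+girth≤ G sc S∈ (ℕP.≮⇒≥ ℓ≮g)

  module _ {h} (sc : ShortestCycle G (suc h)) (h<n : h < n) where

    private
      k₀ = n ∸ h
      h≤n = ℕP.<⇒≤ h<n
      n∸k₀≡h : n ∸ k₀ ≡ h
      n∸k₀≡h = ℕP.m∸[m∸n]≡n h≤n
      k₀+g≡1+n : k₀ ℕ.+ suc h ≡ suc n
      k₀+g≡1+n = m∸n+1+n≡1+m h≤n
      isCycleEdges : List (Edge n) → Bool
      isCycleEdges S = (length S ℕ.≡ᵇ suc h) ∧ (components n S ℕ.≡ᵇ k₀)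
      forests : List (Edge n) → ℚ
      forests S = if length S ℕ.≡ᵇ h then signℚ h else 0ℚ
      cycles : List (Edge n) → ℚ
      cycles S = if isCycleEdges S then signℚ (suc h) else 0ℚ
      #cycles : ℕ
      #cycles = sum (map (λ S → if isCycleEdges S then 1 else 0) (sublists (edges G)))

    longer⇒components≢k₀ : ∀ {S} → S ∈ sublists (edges G) → suc h < length S → components n S ≢ k₀
    longer⇒components≢k₀ {S} S∈ g<ℓ c≡k₀ = ℕP.<-irrefl refl (begin-strict
      suc n                       ≡⟨ k₀+g≡1+n ⟨
      k₀ ℕ.+ suc h                ≡⟨ cong (ℕ._+ suc h) c≡k₀ ⟨
      components n S ℕ.+ suc h    ≤⟨ longer⇒components+girth≤size G sc S∈ g<ℓ ⟩
      n                           <⟨ ℕP.n<1+n n ⟩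
      suc n                       ∎)
      where open ℕP.≤-Reasoning

    -- The edge sets with n - g + 1 components: the forests with g - 1 edges, and the edge
    -- sets of the shortest cycles.
    term≡forests+cycles : ∀ {S} → S ∈ sublists (edges G) → term k₀ S ≡ forests S + cycles S
    term≡forests+cycles {S} S∈ with ℕP.<-cmp (length S) (suc h)
    ... | tri< ℓ<g _ _ = begin
      term k₀ S                                          ≡⟨ cong (λ b → if b then signℚ (length S) else 0ℚ)
                                                              (forest⇒≡ᵇ (components n S) (length S) k₀ (short⇒forest G sc S∈ ℓ<g) (ℕP.m∸n≤m n h)) ⟩
      (if length S ℕ.≡ᵇ n ∸ k₀ then signℚ (length S) else 0ℚ) ≡⟨ cong (λ k → if length S ℕ.≡ᵇ k then signℚ (length S) else 0ℚ) n∸k₀≡h ⟩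
      (if length S ℕ.≡ᵇ h then signℚ (length S) else 0ℚ) ≡⟨ if-≡ᵇ (length S) h signℚ ⟩
      forests S                                          ≡⟨ ℚP.+-identityʳ (forests S) ⟨
      forests S + 0ℚ                                     ≡⟨ cong (λ b → forests S + (if b ∧ (components n S ℕ.≡ᵇ k₀) then signℚ (suc h) else 0ℚ))
                                                              (dec-false (length S ℕ.≟ suc h) (ℕP.<⇒≢ ℓ<g)) ⟨
      forests S + cycles S                               ∎
      where open ≡-Reasoning
    ... | tri≈ _ ℓ≡g _ rewrite ℓ≡g | dec-true (suc h ℕ.≟ suc h) refl | dec-false (suc h ℕ.≟ h) ℕP.1+n≢n =
      sym (ℚP.+-identityˡ _)
    ... | tri> _ _ g<ℓ = begin
      term k₀ S      ≡⟨ cong (λ b → if b then signℚ (length S) else 0ℚ) (dec-false (components n S ℕ.≟ k₀) (longer⇒components≢k₀ S∈ g<ℓ)) ⟩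
      0ℚ + 0ℚ        ≡⟨ cong₂ _+_ (cong (λ b → if b then signℚ h else 0ℚ) (dec-false (length S ℕ.≟ h) ℓ≢h))
                                  (cong (λ b → if b ∧ (components n S ℕ.≡ᵇ k₀) then signℚ (suc h) else 0ℚ)
                                        (dec-false (length S ℕ.≟ suc h) (ℕP.>⇒≢ g<ℓ))) ⟨
      forests S + cycles S ∎
      where
      open ≡-Reasoning
      ℓ≢h : length S ≢ h
      ℓ≢h ℓ≡h = ℕP.<-asym g<ℓ (subst (_< suc h) (sym ℓ≡h) (ℕP.n<1+n h))

    1≤#cycles : 1 ≤ #cycles
    1≤#cycles with shortest-cycle-edges G sc
    ... | S , S∈ , ℓ≡g , c+g≡1+n = ℕP.≤-trans (ℕP.≤-reflexive (cong (λ b → if b then 1 else 0) (sym S-counted)))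
                                              (∈⇒≤∑ (λ S → if isCycleEdges S then 1 else 0) S∈)
      where
      S-counted : isCycleEdges S ≡ true
      S-counted rewrite dec-true (length S ℕ.≟ suc h) ℓ≡g =
        dec-true (components n S ℕ.≟ k₀) (ℕP.+-cancelʳ-≡ (suc h) _ _ (trans c+g≡1+n (sym k₀+g≡1+n)))
      ∈⇒≤∑ : ∀ {B : Set} (f : B → ℕ) {x xs} → x ∈ xs → f x ≤ sum (map f xs)
      ∈⇒≤∑ f (here refl) = ℕP.m≤m+n _ _
      ∈⇒≤∑ f {xs = y ∷ _} (there x∈) = ℕP.≤-trans (∈⇒≤∑ f x∈) (ℕP.m≤n+m _ (f y))

    whitney≢signedBinom : whitney G k₀ ≢ signedBinom n (edgeCount G) k₀
    whitney≢signedBinom whitney≡ = ℕP.<-irrefl (sym #cycles≡0) 1≤#cycles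
      where
      F = ℕ→ℚ (length (edges G) C h) * signℚ h
      Y = ℕ→ℚ #cycles * signℚ (suc h)
      whitney≡F+Y : whitney G k₀ ≡ F + Y
      whitney≡F+Y = begin
        whitney G k₀                                                        ≡⟨ ∑ℚ.∑-cong (sublists (edges G)) (λ _ → term≡forests+cycles) ⟩
        sumℚ (map (λ S → forests S + cycles S) (sublists (edges G)))        ≡⟨ ∑ℚ.∑-map-+ forests cycles (sublists (edges G)) ⟩
        sumℚ (map forests (sublists (edges G))) + sumℚ (map cycles (sublists (edges G)))
          ≡⟨ cong₂ _+_ (∑-sublists-of-length (edges G) h (signℚ h)) (∑-if isCycleEdges (signℚ (suc h)) (sublists (edges G))) ⟩
        F + Y                                                               ∎
        where open ≡-Reasoning
      signedBinom≡F : signedBinom n (edgeCount G) k₀ ≡ F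
      signedBinom≡F = begin
        signedBinom n (edgeCount G) k₀                     ≡⟨ signedBinom-≤ (edgeCount G) (ℕP.m∸n≤m n h) ⟩
        signℚ (n ∸ k₀) * ℕ→ℚ (edgeCount G C (n ∸ k₀))      ≡⟨ cong₂ (λ j m → signℚ j * ℕ→ℚ (m C j)) n∸k₀≡h (edgeCount≡length-edges G) ⟩
        signℚ h * ℕ→ℚ (length (edges G) C h)               ≡⟨ ℚP.*-comm (signℚ h) _ ⟩
        F                                                  ∎
        where open ≡-Reasoning
      Y≡0 : Y ≡ 0ℚ
      Y≡0 = begin
        Y              ≡⟨ solve 2 (λ f y → y := (f :+ y) :- f) refl F Y ⟩
        (F + Y) - F    ≡⟨ cong (_- F) (trans (sym whitney≡F+Y) (trans whitney≡ signedBinom≡F)) ⟩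
        F - F          ≡⟨ ℚP.+-inverseʳ F ⟩
        0ℚ             ∎
        where open ≡-Reasoning
      #cycles≡0 : #cycles ≡ 0
      #cycles≡0 = ℕ→ℚ-injective (p≢0∧p*q≡0⇒q≡0 (signℚ≢0 (suc h)) (trans (ℚP.*-comm (signℚ (suc h)) _) Y≡0))

module _ {n} (G : SimpleGraph n) (c : List ℕ → ℚ) (expansion : IsPowerSumExpansion G c) where

  beyond-size⇒¬Deviates : ∀ {k} → n < k → ¬ Deviates G c k
  beyond-size⇒¬Deviates {k} n<k deviates = deviates (trans (sumLength-beyond n k c n<k)
    (sym (cong (λ b → if b then signℚ (n ∸ k) * ℕ→ℚ (edgeCount G C (n ∸ k)) else 0ℚ)
               (dec-false (k ℕ.≤? n) (ℕP.<⇒≱ n<k)))))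

  whitney≡⇒¬Deviates : ∀ {k} → k ≤ n → whitney G k ≡ signedBinom n (edgeCount G) k → ¬ Deviates G c k
  whitney≡⇒¬Deviates {k} k≤n whitney≡ deviates = deviates (trans (sumLength≡whitney G c expansion k k≤n) whitney≡)

  acyclic⇒¬Deviates : Acyclic G → ∀ k → ¬ Deviates G c k
  acyclic⇒¬Deviates acyclic k = [ (λ k≤n → whitney≡⇒¬Deviates k≤n (acyclic⇒whitney≡signedBinom G acyclic k≤n))
                                 , beyond-size⇒¬Deviates ]′ (ℕP.≤-<-connex k n)

  above-girth⇒¬Deviates : ∀ {g} → ShortestCycle G g → ∀ {k} → suc n < k ℕ.+ g → ¬ Deviates G c k
  above-girth⇒¬Deviates sc {k} n<k+g =
    [ (λ k≤n → whitney≡⇒¬Deviates k≤n (above-girth⇒whitney≡signedBinom G sc k≤n n<k+g))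
    , beyond-size⇒¬Deviates ]′ (ℕP.≤-<-connex k n)

  girth⇒Deviates : ∀ {h} → ShortestCycle G (suc h) → h < n → Deviates G c (n ∸ h)
  girth⇒Deviates {h} sc h<n sumLength≡ =
    whitney≢signedBinom G sc h<n (trans (sym (sumLength≡whitney G c expansion (n ∸ h) (ℕP.m∸n≤m n h))) sumLength≡)

  largest-Deviates≡ : ∀ {h} → ShortestCycle G (suc h) → h < n → ∀ {k} → Deviates G c k →
                      (∀ k′ → k < k′ → Deviates G c k′ → ⊥) → k ≡ n ∸ h
  largest-Deviates≡ {h} sc h<n {k} deviates none-above = case ℕP.<-cmp k (n ∸ h) of λ
    { (tri< k<k₀ _ _) → ⊥-elim (none-above (n ∸ h) k<k₀ (girth⇒Deviates sc h<n))
    ; (tri≈ _ k≡k₀ _) → k≡k₀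
    ; (tri> _ _ k₀<k) → ⊥-elim (above-girth⇒¬Deviates sc
        (subst (_< k ℕ.+ suc h) (m∸n+1+n≡1+m (ℕP.<⇒≤ h<n)) (ℕP.+-monoˡ-< (suc h) k₀<k)) deviates) }

proposition1p2 : ∀ {n : ℕ} (G : SimpleGraph n) (c : List ℕ → ℚ) →
    IsPowerSumExpansion G c →
    (∀ (k : ℕ) → Deviates G c k → (∀ k′ → k < k′ → Deviates G c k′ → ⊥) →
       (k ≤ n) × GirthIs G (suc (n ∸ k)))
    × ((∀ (k : ℕ) → Deviates G c k → ⊥) → Acyclic G)
proposition1p2 {n} G c expansion = largest-deviation , never-deviates⇒acyclic
  where
  largest-deviation : ∀ k → Deviates G c k → (∀ k′ → k < k′ → Deviates G c k′ → ⊥) →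
                      k ≤ n × GirthIs G (suc (n ∸ k))
  largest-deviation k deviates none-above = case acyclic-or-girth G of λ
    { (inj₁ acyclic)     → ⊥-elim (acyclic⇒¬Deviates G c expansion acyclic k deviates)
    ; (inj₂ (h , girth)) → let sc , h<n = girth⇒ShortestCycle G girth in
        case largest-Deviates≡ G c expansion sc h<n deviates none-above of λ
          { refl → ℕP.m∸n≤m n h , subst (GirthIs G ∘ suc) (sym (ℕP.m∸[m∸n]≡n (ℕP.<⇒≤ h<n))) girth } }
  never-deviates⇒acyclic : (∀ k → Deviates G c k → ⊥) → Acyclic G
  never-deviates⇒acyclic never = case acyclic-or-girth G of λ
    { (inj₁ acyclic)     → acyclic
    ; (inj₂ (h , girth)) → let sc , h<n = girth⇒ShortestCycle G girth in
        ⊥-elim (never (n ∸ h) (girth⇒Deviates G c expansion sc h<n)) }
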